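{- Let $\varepsilon=\pm1$ and $n\ge2$. Then $$\sum_{\gamma\in\Delta^<_n}\varepsilon^{\ell_B(\gamma)}q^{\mathrm{fmaj}(\gamma)}=\varepsilon^nq\,[2]_{\varepsilon q}[4]_q[6]_{\varepsilon q}\cdots[2n-2]_{\varepsilon^{n-1}q}\,[n-1]_{\varepsilon^nq}=\varepsilon^nq\left(\frac{1-q}{1-\varepsilon q}\right)^{\lceil\frac n2\rceil}[2]_q[4]_q\cdots[2n-2]_q[n-1]_q,$$ where the $i$-th factor in the product is $[2i]_{\varepsilon^iq}$ for $i=1,\dots,n-1$.
   Context: $B_n$ is the group of signed permutations $\gamma=\gamma_1\cdots\gamma_n$ of $[n]$, and $\Delta^<_n=\{\gamma\in B_n:0<\gamma_n<n\}$. $\ell_B(\gamma)=\mathrm{inv}(\gamma)-\sum_{i:\gamma_i<0}\gamma_i$ ($\mathrm{inv}$ in usual integer order). With the order $-1\prec-2\prec\cdots\prec-n\prec1\prec\cdots\prec n$, $\mathrm{maj}_\prec(\gamma)=\sum\{i:\gamma_{i+1}\prec\gamma_i\}$ and $\mathrm{fmaj}(\gamma)=2\mathrm{maj}_\prec(\gamma)+\#\{i:\gamma_i<0\}$. $[m]_x=1+x+\cdots+x^{m-1}$ (with $x=\pm q$ as indicated). -}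

module Defs where

open import Level using (Level)
open import Data.Bool using (Bool; true; false; if_then_else_; _∧_; _∨_)
open import Data.Nat as ℕ using (ℕ; zero; suc)
import Data.Nat.Properties as ℕP
open import Data.Integer as ℤ using (ℤ; +_; -[1+_]; ∣_∣)
import Data.Integer.Properties as ℤP
open import Data.List using (List; []; _∷_; _++_; map; concatMap; filter; upTo; length; foldr; last)
open import Data.Maybe using (Maybe; just; nothing)
open import Data.Sign using (Sign)
open import Relation.Nullary.Decidable using (⌊_⌋)
open import Data.List.Relation.Unary.Unique.DecPropositional ℕ._≟_ using (unique?)
open import Algebra.Bundles using (CommutativeRing)
import Algebra.Bundles

-- Signed permutations are represented as words γ = γ₁ ⋯ γₙ (lists of
-- integers) in the alphabet {-n,…,-1,1,…,n} such that |γ₁|,…,|γₙ| are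
-- pairwise distinct (hence a permutation of [n]).

signedRange : ℕ → List ℤ
signedRange n = map (λ k → -[1+ k ]) (upTo n) ++ map (λ k → + suc k) (upTo n)

words : ℕ → List ℤ → List (List ℤ)
words zero    L = [] ∷ []
words (suc m) L = concatMap (λ a → map (a ∷_) (words m L)) L

Bn : ℕ → List (List ℤ)
Bn n = filter (λ γ → unique? (map ∣_∣ γ)) (words n (signedRange n))

lastCond : ℕ → List ℤ → Bool
lastCond n γ with last γ
... | just (+ k)    = ⌊ 0 ℕ.<? k ⌋ ∧ ⌊ k ℕ.<? n ⌋
... | just -[1+ _ ] = false
... | nothing       = false

Δ< : ℕ → List (List ℤ)
Δ< n = filter (λ γ → lastCond n γ Data.Bool.≟ true) (Bn n)

inv : List ℤ → ℕ
inv []      = 0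
inv (a ∷ w) = length (filter (λ b → b ℤP.<? a) w) ℕ.+ inv w

negAbsSum : List ℤ → ℕ
negAbsSum []             = 0
negAbsSum (+ _ ∷ w)      = negAbsSum w
negAbsSum (-[1+ k ] ∷ w) = suc k ℕ.+ negAbsSum w

ℓB : List ℤ → ℕ
ℓB γ = inv γ ℕ.+ negAbsSum γ

negCount : List ℤ → ℕ
negCount []             = 0
negCount (+ _ ∷ w)      = negCount w
negCount (-[1+ _ ] ∷ w) = suc (negCount w)

-- the order  -1 ≺ -2 ≺ ⋯ ≺ -n ≺ 1 ≺ ⋯ ≺ n  (b ≺ a)
_≺_ : ℤ → ℤ → Bool
-[1+ b ] ≺ -[1+ a ] = ⌊ b ℕ.<? a ⌋
-[1+ b ] ≺ (+ a)    = true
(+ b)    ≺ -[1+ a ] = false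
(+ b)    ≺ (+ a)    = ⌊ b ℕ.<? a ⌋

majFrom : ℕ → List ℤ → ℕ
majFrom i []            = 0
majFrom i (a ∷ [])      = 0
majFrom i (a ∷ b ∷ w)   = (if b ≺ a then i else 0) ℕ.+ majFrom (suc i) (b ∷ w)

maj≺ : List ℤ → ℕ
maj≺ = majFrom 1

fmaj : List ℤ → ℕ
fmaj γ = 2 ℕ.* maj≺ γ ℕ.+ negCount γ

-- Ring-valued quantities (q a variable in an arbitrary commutative ring)
module RingDefs {c ℓ : Level} (R : CommutativeRing c ℓ) where
  open CommutativeRing R
  open import Algebra.Definitions.RawSemiring (Algebra.Bundles.Semiring.rawSemiring semiring) using (_^_)

  sgn : Sign → Carrier
  sgn Sign.+ = 1#
  sgn Sign.- = - 1#

  [_]_ : ℕ → Carrier → Carrier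
  [ m ] x = foldr (λ k s → x ^ k + s) 0# (upTo m)

  sumR : List Carrier → Carrier
  sumR = foldr _+_ 0#

  prodR : List Carrier → Carrier
  prodR = foldr _*_ 1#

  lhs : Sign → ℕ → Carrier → Carrier
  lhs ε n q = sumR (map (λ γ → (sgn ε ^ ℓB γ) * (q ^ fmaj γ)) (Δ< n))

  rhs₁ : Sign → ℕ → Carrier → Carrier
  rhs₁ ε n q =
    (sgn ε ^ n) * q
      * prodR (map (λ k → [ 2 ℕ.* suc k ] ((sgn ε ^ suc k) * q)) (upTo (n ℕ.∸ 1)))
      * [ n ℕ.∸ 1 ] ((sgn ε ^ n) * q)

  -- ε^n q (1-q)^{⌈n/2⌉} [2]_q [4]_q ⋯ [2n-2]_q [n-1]_q
  -- (numerator of the third expression, after clearing (1-εq)^{⌈n/2⌉})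
  rhs₂num : Sign → ℕ → Carrier → Carrier
  rhs₂num ε n q =
    (sgn ε ^ n) * q * ((1# - q) ^ ℕ.⌈ n /2⌉)
      * prodR (map (λ k → [ 2 ℕ.* suc k ] q) (upTo (n ℕ.∸ 1)))
      * [ n ℕ.∸ 1 ] q

  rhs₂den : Sign → ℕ → Carrier → Carrier
  rhs₂den ε n q = (1# - sgn ε * q) ^ ℕ.⌈ n /2⌉

-- Removing the last letter a of a signed permutation of [k + 1] and
-- standardising the rest is a bijection onto {±1, …, ±(k + 1)} × B_k, inverted by
-- insertLast. Inserting a into γ ∈ B_k raises ℓ_B by an amount depending only on a
-- (d if a = j + 1 with j + d = k, and k + j + 1 if a = -(j + 1)) and raises fmaj by
-- [a < 0], plus 2k when a ≺ the lifted last letter of γ. Hence the weighted sum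
-- S_k(a) over the permutations of [k + 1] ending in a satisfies a recursion in k,
-- solved by S_k(j + 1) = x^d P_k and S_k(-(j + 1)) = x^(k + 1 + d) P_k for j + d = k,
-- where x = ε^(k+1) q and P_k = [2]_{εq} ⋯ [2k]_{ε^k q}; the inductive step is the
-- identity x^d [2K]_x = [2K]_x with its first d terms multiplied by x^(2K). Summing
-- S_{n-1}(j + 1) over j + 1 < n gives the first formula. For the second, when ε = -1
-- every factor [2m]_{-q} satisfies (1 + q)[2m]_{-q} = (1 - q)[2m]_q, and exactly
-- ⌈n/2⌉ of the factors carry an odd power of ε.

module Submission where

open import Defs
open import Level using (Level)
open import Function using (_∘_)
open import Function.Bundles using (_⇔_; mk⇔)
open import Data.Bool using (Bool; true; false; if_then_else_; _∧_)
import Data.Bool as Bool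
open import Data.Maybe using (just)
open import Data.Empty using (⊥-elim)
open import Data.Product as Product using (∃₂; _×_; _,_; proj₁; proj₂)
open import Data.Sum using (inj₁; inj₂)
open import Data.Nat as ℕ using (ℕ; zero; suc; _≤_; _<_; z≤n; s≤s)
import Data.Nat.Properties as ℕP
open import Data.Nat.Tactic.RingSolver using (solve-∀)
open import Algebra.Properties.CommutativeSemigroup ℕP.+-commutativeSemigroup using () renaming (interchange to +-interchange)
open import Data.Integer as ℤ using (ℤ; +_; -[1+_]; ∣_∣)
import Data.Integer.Properties as ℤP
import Data.Sign as Sign
open import Data.Sign using (Sign)
open import Data.List using (List; []; _∷_; _++_; _∷ʳ_; map; foldr; upTo; filter; length; last; concatMap; cartesianProductWith; initLast; _∷ʳ′_)
import Data.List.Properties as LP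
open import Data.List.Membership.Propositional using (_∈_)
open import Data.List.Membership.Propositional.Properties
open import Data.List.Membership.Propositional.Properties.WithK using (unique∧set⇒bag)
open import Data.List.Relation.Unary.All as All using (All; []; _∷_)
import Data.List.Relation.Unary.All.Properties as AllP
open import Data.List.Relation.Unary.Any using (here; there)
open import Data.List.Relation.Unary.AllPairs using ([]; _∷_)
open import Data.List.Relation.Unary.Unique.Propositional using (Unique)
import Data.List.Relation.Unary.Unique.Propositional.Properties as UniqueP
open import Data.List.Relation.Unary.Unique.DecPropositional ℕ._≟_ using (unique?)
open import Data.List.Relation.Binary.Disjoint.Propositional using (Disjoint)
open import Data.List.Relation.Binary.BagAndSetEquality using (∼bag⇒↭)
open import Data.List.Relation.Binary.Permutation.Propositional using (_↭_; ↭⇒↭ₛ′)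
import Data.List.Relation.Binary.Permutation.Propositional.Properties as PermP
import Data.List.Relation.Binary.Permutation.Setoid.Properties as PermSetoidP
open import Relation.Nullary using (¬_; Dec; yes; no)
open import Relation.Nullary.Decidable using (⌊_⌋; isYes≗does; dec-true; dec-false; does-⇔)
open import Relation.Binary.Definitions using (tri<; tri≈; tri>)
open import Relation.Binary.PropositionalEquality as ≡ using (_≡_; _≢_)
open import Algebra.Bundles using (CommutativeRing)
import Algebra.Bundles

module SignedPermutations where
  open ≡ using (refl; sym; trans; cong; cong₂; subst; module ≡-Reasoning)

  isYes-true : ∀ {P : Set} (p? : Dec P) → P → ⌊ p? ⌋ ≡ true
  isYes-true p? p = trans (isYes≗does p?) (dec-true p? p)

  isYes-false : ∀ {P : Set} (p? : Dec P) → ¬ P → ⌊ p? ⌋ ≡ false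
  isYes-false p? ¬p = trans (isYes≗does p?) (dec-false p? ¬p)

  isYes-⇔ : ∀ {P Q : Set} (p? : Dec P) (q? : Dec Q) → P ⇔ Q → ⌊ p? ⌋ ≡ ⌊ q? ⌋
  isYes-⇔ p? q? p⇔q = trans (isYes≗does p?) (trans (does-⇔ p⇔q p? q?) (sym (isYes≗does q?)))

  suc-pred-of-pos : ∀ {n} → 0 < n → suc (ℕ.pred n) ≡ n
  suc-pred-of-pos (s≤s _) = refl

  concatMap-map≡cartesianProductWith : ∀ {A B C : Set} (f : A → B → C) xs ys →
    concatMap (λ x → map (f x) ys) xs ≡ cartesianProductWith f xs ys
  concatMap-map≡cartesianProductWith f [] ys = refl
  concatMap-map≡cartesianProductWith f (x ∷ xs) ys = cong (map (f x) ys ++_) (concatMap-map≡cartesianProductWith f xs ys)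

  unique-∷ʳ⁻ : ∀ {A : Set} (xs : List A) {y} → Unique (xs ∷ʳ y) → Unique xs × All (_≢ y) xs
  unique-∷ʳ⁻ [] _ = [] , []
  unique-∷ʳ⁻ (x ∷ xs) (x≢rest ∷ rest-unique) = Product.zip _∷_ _∷_
    (AllP.∷ʳ⁻ x≢rest) (unique-∷ʳ⁻ xs rest-unique)

  last-∷ʳ : ∀ {A : Set} (xs : List A) a → last (xs ∷ʳ a) ≡ just a
  last-∷ʳ [] a = refl
  last-∷ʳ (x ∷ []) a = refl
  last-∷ʳ (x ∷ y ∷ xs) a = last-∷ʳ (y ∷ xs) a

  ≤⇔∸< : ∀ {j d k i} → j ℕ.+ d ≡ suc k → i ≤ k → j ≤ i ⇔ k ℕ.∸ i < d
  ≤⇔∸< {j} {d} {k} {i} j+d≡ i≤k = mk⇔ to from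
    where
    open ℕP.≤-Reasoning
    to : j ≤ i → k ℕ.∸ i < d
    to j≤i = ℕP.+-cancelʳ-< i (k ℕ.∸ i) d (begin
      suc (k ℕ.∸ i ℕ.+ i) ≡⟨ cong suc (ℕP.m∸n+n≡m i≤k) ⟩
      suc k               ≡⟨ j+d≡ ⟨
      j ℕ.+ d             ≤⟨ ℕP.+-monoˡ-≤ d j≤i ⟩
      i ℕ.+ d             ≡⟨ ℕP.+-comm i d ⟩
      d ℕ.+ i             ∎)
    from : k ℕ.∸ i < d → j ≤ i
    from k∸i<d = ℕP.+-cancelʳ-≤ d j i (begin
      j ℕ.+ d             ≡⟨ j+d≡ ⟩
      suc k               ≡⟨ cong suc (ℕP.m∸n+n≡m i≤k) ⟨
      suc (k ℕ.∸ i) ℕ.+ i ≤⟨ ℕP.+-monoˡ-≤ i k∸i<d ⟩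
      d ℕ.+ i             ≡⟨ ℕP.+-comm d i ⟩
      i ℕ.+ d             ∎)

  data Parity : ℕ → Set where
    even : ∀ m → Parity (m ℕ.+ m)
    odd : ∀ m → Parity (suc (m ℕ.+ m))

  parity : ∀ n → Parity n
  parity zero = even 0
  parity (suc n) with parity n
  ... | even m = odd m
  ... | odd m = subst Parity (cong suc (ℕP.+-suc m m)) (even (suc m))

  indicator : Bool → ℕ
  indicator true = 1
  indicator false = 0

  count : {A : Set} → (A → Bool) → List A → ℕ
  count f [] = 0
  count f (x ∷ xs) = indicator (f x) ℕ.+ count f xs

  count-++ : ∀ {A : Set} (f : A → Bool) xs ys → count f (xs ++ ys) ≡ count f xs ℕ.+ count f ys
  count-++ f [] ys = refl
  count-++ f (x ∷ xs) ys = trans (cong (indicator (f x) ℕ.+_) (count-++ f xs ys)) (sym (ℕP.+-assoc (indicator (f x)) _ _))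

  count-map : ∀ {A B : Set} (f : B → Bool) (g : A → B) xs → count f (map g xs) ≡ count (f ∘ g) xs
  count-map f g [] = refl
  count-map f g (x ∷ xs) = cong (indicator (f (g x)) ℕ.+_) (count-map f g xs)

  count-cong : ∀ {A : Set} {f g : A → Bool} → (∀ x → f x ≡ g x) → ∀ xs → count f xs ≡ count g xs
  count-cong f≗g [] = refl
  count-cong f≗g (x ∷ xs) = cong₂ (λ b n → indicator b ℕ.+ n) (f≗g x) (count-cong f≗g xs)

  count-+ : ∀ {A : Set} (f g h : A → Bool) → (∀ x → indicator (f x) ℕ.+ indicator (g x) ≡ indicator (h x)) →
    ∀ xs → count f xs ℕ.+ count g xs ≡ count h xs
  count-+ f g h pointwise [] = refl
  count-+ f g h pointwise (x ∷ xs) = trans (+-interchange (indicator (f x)) _ _ _)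
    (cong₂ ℕ._+_ (pointwise x) (count-+ f g h pointwise xs))

  count-true : ∀ {A : Set} (xs : List A) → count (λ _ → true) xs ≡ length xs
  count-true [] = refl
  count-true (x ∷ xs) = cong suc (count-true xs)

  -- Inserting a letter of absolute value p + 1 moves the absolute values above p up by one.
  shiftAbove : ℕ → ℕ → ℕ
  shiftAbove p x with x ℕ.≤? p
  ... | yes _ = x
  ... | no _ = suc x

  shiftAbove-≤ : ∀ {p x} → x ≤ p → shiftAbove p x ≡ x
  shiftAbove-≤ {p} {x} x≤p with x ℕ.≤? p
  ... | yes _ = refl
  ... | no x≰p = ⊥-elim (x≰p x≤p)

  shiftAbove-> : ∀ {p x} → p < x → shiftAbove p x ≡ suc x
  shiftAbove-> {p} {x} p<x with x ℕ.≤? p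
  ... | yes x≤p = ⊥-elim (ℕP.<⇒≱ p<x x≤p)
  ... | no _ = refl

  x≤shiftAbove : ∀ p x → x ≤ shiftAbove p x
  x≤shiftAbove p x with x ℕ.≤? p
  ... | yes _ = ℕP.≤-refl
  ... | no _ = ℕP.n≤1+n x

  shiftAbove≤suc : ∀ p x → shiftAbove p x ≤ suc x
  shiftAbove≤suc p x with x ℕ.≤? p
  ... | yes _ = ℕP.n≤1+n x
  ... | no _ = ℕP.≤-refl

  shiftAbove-mono-< : ∀ p {x y} → x < y → shiftAbove p x < shiftAbove p y
  shiftAbove-mono-< p {x} {y} x<y with x ℕ.≤? p | y ℕ.≤? p
  ... | yes _ | yes _ = x<y
  ... | yes _ | no _ = ℕP.m<n⇒m<1+n x<y
  ... | no x≰p | yes y≤p = ⊥-elim (x≰p (ℕP.≤-trans (ℕP.<⇒≤ x<y) y≤p))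
  ... | no _ | no _ = s≤s x<y

  shiftAbove-cancel-< : ∀ p {x y} → shiftAbove p x < shiftAbove p y → x < y
  shiftAbove-cancel-< p {x} {y} lt with ℕP.<-cmp x y
  ... | tri< x<y _ _ = x<y
  ... | tri≈ _ refl _ = ⊥-elim (ℕP.<-irrefl refl lt)
  ... | tri> _ _ y<x = ⊥-elim (ℕP.<-asym lt (shiftAbove-mono-< p y<x))

  shiftAbove-injective : ∀ p {x y} → shiftAbove p x ≡ shiftAbove p y → x ≡ y
  shiftAbove-injective p {x} {y} eq with ℕP.<-cmp x y
  ... | tri< x<y _ _ = ⊥-elim (ℕP.<-irrefl eq (shiftAbove-mono-< p x<y))
  ... | tri≈ _ x≡y _ = x≡y
  ... | tri> _ _ y<x = ⊥-elim (ℕP.<-irrefl (sym eq) (shiftAbove-mono-< p y<x))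

  shiftAbove-≢ : ∀ p x → shiftAbove p x ≢ suc p
  shiftAbove-≢ p x eq with x ℕ.≤? p
  ... | yes x≤p = ℕP.<-irrefl eq (s≤s x≤p)
  ... | no x≰p = x≰p (ℕP.≤-reflexive (ℕP.suc-injective eq))

  shiftAbove-suc : ∀ p v → shiftAbove p (suc v) ≡ suc v ℕ.+ indicator ⌊ p ℕ.≤? v ⌋
  shiftAbove-suc p v with p ℕ.≤? v
  ... | yes p≤v = trans (shiftAbove-> (s≤s p≤v)) (ℕP.+-comm 1 (suc v))
  ... | no p≰v = trans (shiftAbove-≤ (ℕP.≰⇒> p≰v)) (sym (ℕP.+-identityʳ (suc v)))

  shiftAbove-≤-low : ∀ {p P} x → P ≤ p → shiftAbove p x ≤ P ⇔ x ≤ P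
  shiftAbove-≤-low {p} x P≤p = mk⇔ (ℕP.≤-trans (x≤shiftAbove p x))
    (λ x≤P → subst (_≤ _) (sym (shiftAbove-≤ (ℕP.≤-trans x≤P P≤p))) x≤P)

  shiftAbove-≤-high : ∀ {p P} x → p ≤ P → shiftAbove p x ≤ suc P ⇔ x ≤ P
  shiftAbove-≤-high {p} {P} x p≤P = mk⇔ from (λ x≤P → ℕP.≤-trans (shiftAbove≤suc p x) (s≤s x≤P))
    where
    from : shiftAbove p x ≤ suc P → x ≤ P
    from le with x ℕ.≤? p
    ... | yes x≤p = ℕP.≤-trans x≤p p≤P
    ... | no _ = ℕP.≤-pred le

  unshiftAbove : ℕ → ℕ → ℕ
  unshiftAbove p y with y ℕ.≤? p
  ... | yes _ = y
  ... | no _ = ℕ.pred y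

  shiftAbove-unshiftAbove : ∀ p y → y ≢ suc p → shiftAbove p (unshiftAbove p y) ≡ y
  shiftAbove-unshiftAbove p y y≢ with y ℕ.≤? p
  ... | yes y≤p = shiftAbove-≤ y≤p
  shiftAbove-unshiftAbove p zero y≢ | no y≰p = ⊥-elim (y≰p z≤n)
  shiftAbove-unshiftAbove p (suc y) y≢ | no y≰p =
    shiftAbove-> (ℕP.≤∧≢⇒< (ℕP.≤-pred (ℕP.≰⇒> y≰p)) (λ p≡y → y≢ (cong suc (sym p≡y))))

  unshiftAbove-pos : ∀ p y → 0 < y → y ≢ suc p → 0 < unshiftAbove p y
  unshiftAbove-pos p y 0<y y≢ with unshiftAbove p y | shiftAbove-unshiftAbove p y y≢
  ... | zero | eq = ⊥-elim (ℕP.<-irrefl (trans (sym (shiftAbove-≤ {p} z≤n)) eq) 0<y)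
  ... | suc _ | _ = s≤s z≤n

  unshiftAbove-≤ : ∀ p k y → y ≤ suc k → p ≤ k → unshiftAbove p y ≤ k
  unshiftAbove-≤ p k y y≤ p≤k with y ℕ.≤? p
  ... | yes y≤p = ℕP.≤-trans y≤p p≤k
  ... | no _ = ℕP.pred-mono-≤ y≤

  liftLetter : ℕ → ℤ → ℤ
  liftLetter p (+ v) = + shiftAbove p v
  liftLetter p -[1+ v ] = -[1+ ℕ.pred (shiftAbove p (suc v)) ]

  lowerLetter : ℕ → ℤ → ℤ
  lowerLetter p (+ v) = + unshiftAbove p v
  lowerLetter p -[1+ v ] = -[1+ ℕ.pred (unshiftAbove p (suc v)) ]

  shiftAbove-suc-pos : ∀ p v → 0 < shiftAbove p (suc v)
  shiftAbove-suc-pos p v = ℕP.<-≤-trans (s≤s z≤n) (x≤shiftAbove p (suc v))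

  ∣liftLetter∣ : ∀ p v → ∣ liftLetter p v ∣ ≡ shiftAbove p ∣ v ∣
  ∣liftLetter∣ p (+ v) = refl
  ∣liftLetter∣ p -[1+ v ] = suc-pred-of-pos (shiftAbove-suc-pos p v)

  liftLetter-injective : ∀ p {x y} → liftLetter p x ≡ liftLetter p y → x ≡ y
  liftLetter-injective p {+ x} {+ y} eq = cong +_ (shiftAbove-injective p (ℤP.+-injective eq))
  liftLetter-injective p { -[1+ x ] } { -[1+ y ] } eq = cong -[1+_] (ℕP.suc-injective (shiftAbove-injective p (begin
    shiftAbove p (suc x)               ≡⟨ sym (suc-pred-of-pos (shiftAbove-suc-pos p x)) ⟩
    suc (ℕ.pred (shiftAbove p (suc x))) ≡⟨ cong suc (ℤP.-[1+-injective eq) ⟩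
    suc (ℕ.pred (shiftAbove p (suc y))) ≡⟨ suc-pred-of-pos (shiftAbove-suc-pos p y) ⟩
    shiftAbove p (suc y)               ∎)))
    where open ≡-Reasoning

  ∣lowerLetter∣ : ∀ p v → 0 < ∣ v ∣ → ∣ v ∣ ≢ suc p → ∣ lowerLetter p v ∣ ≡ unshiftAbove p ∣ v ∣
  ∣lowerLetter∣ p (+ y) _ _ = refl
  ∣lowerLetter∣ p -[1+ y ] 0<∣v∣ ∣v∣≢ = suc-pred-of-pos (unshiftAbove-pos p (suc y) 0<∣v∣ ∣v∣≢)

  liftLetter-lowerLetter : ∀ p v → 0 < ∣ v ∣ → ∣ v ∣ ≢ suc p → liftLetter p (lowerLetter p v) ≡ v
  liftLetter-lowerLetter p (+ y) _ ∣v∣≢ = cong +_ (shiftAbove-unshiftAbove p y ∣v∣≢)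
  liftLetter-lowerLetter p -[1+ y ] 0<∣v∣ ∣v∣≢ = cong (λ z → -[1+ ℕ.pred z ]) (trans
    (cong (shiftAbove p) (suc-pred-of-pos (unshiftAbove-pos p (suc y) 0<∣v∣ ∣v∣≢)))
    (shiftAbove-unshiftAbove p (suc y) ∣v∣≢))

  IsLetter : ℕ → ℤ → Set
  IsLetter k v = 0 < ∣ v ∣ × ∣ v ∣ ≤ k

  IsSignedPerm : ℕ → List ℤ → Set
  IsSignedPerm k γ = length γ ≡ k × All (IsLetter k) γ × Unique (map ∣_∣ γ)

  lowerLetter-isLetter : ∀ p k v → IsLetter (suc k) v → ∣ v ∣ ≢ suc p → p ≤ k → IsLetter k (lowerLetter p v)
  lowerLetter-isLetter p k v (0<∣v∣ , ∣v∣≤) ∣v∣≢ p≤k rewrite ∣lowerLetter∣ p v 0<∣v∣ ∣v∣≢ =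
    unshiftAbove-pos p (∣ v ∣) 0<∣v∣ ∣v∣≢ , unshiftAbove-≤ p k (∣ v ∣) ∣v∣≤ p≤k

  liftLetter-isLetter : ∀ p {k v} → IsLetter k v → IsLetter (suc k) (liftLetter p v)
  liftLetter-isLetter p {k} {v} (0<∣v∣ , ∣v∣≤k) rewrite ∣liftLetter∣ p v =
    ℕP.<-≤-trans 0<∣v∣ (x≤shiftAbove p ∣ v ∣) , ℕP.≤-trans (shiftAbove≤suc p ∣ v ∣) (s≤s ∣v∣≤k)

  map-∣liftLetter∣ : ∀ p γ → map ∣_∣ (map (liftLetter p) γ) ≡ map (shiftAbove p) (map ∣_∣ γ)
  map-∣liftLetter∣ p γ = trans (sym (LP.map-∘ γ)) (trans (LP.map-cong (∣liftLetter∣ p) γ) (LP.map-∘ γ))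

  ∈-signedRange⁻ : ∀ {k v} → v ∈ signedRange k → IsLetter k v
  ∈-signedRange⁻ {k} v∈ with ∈-++⁻ (map (λ j → -[1+ j ]) (upTo k)) v∈
  ... | inj₁ v∈neg with j , j∈ , refl ← ∈-map⁻ _ v∈neg = s≤s z≤n , ∈-upTo⁻ j∈
  ... | inj₂ v∈pos with j , j∈ , refl ← ∈-map⁻ _ v∈pos = s≤s z≤n , ∈-upTo⁻ j∈

  ∈-signedRange⁺ : ∀ {k v} → IsLetter k v → v ∈ signedRange k
  ∈-signedRange⁺ {k} {+ suc j} (_ , j<k) =
    ∈-++⁺ʳ (map (λ j → -[1+ j ]) (upTo k)) (∈-map⁺ (λ j → + suc j) (∈-upTo⁺ j<k))
  ∈-signedRange⁺ {k} { -[1+ j ] } (_ , j<k) = ∈-++⁺ˡ (∈-map⁺ (λ j → -[1+ j ]) (∈-upTo⁺ j<k))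

  signedRange-unique : ∀ k → Unique (signedRange k)
  signedRange-unique k = UniqueP.++⁺
    (UniqueP.map⁺ ℤP.-[1+-injective (UniqueP.upTo⁺ k))
    (UniqueP.map⁺ (ℕP.suc-injective ∘ ℤP.+-injective) (UniqueP.upTo⁺ k))
    neg∩pos
    where
    neg∩pos : Disjoint (map (λ j → -[1+ j ]) (upTo k)) (map (λ j → + suc j) (upTo k))
    neg∩pos (v∈neg , v∈pos) with ∈-map⁻ _ v∈neg | ∈-map⁻ _ v∈pos
    ... | _ , _ , refl | _ , _ , ()

  words-suc : ∀ m L → words (suc m) L ≡ cartesianProductWith _∷_ L (words m L)
  words-suc m L = concatMap-map≡cartesianProductWith _∷_ L (words m L)

  ∈-words⁻ : ∀ m L {w} → w ∈ words m L → length w ≡ m × All (_∈ L) w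
  ∈-words⁻ zero L (here refl) = refl , []
  ∈-words⁻ (suc m) L w∈
    with a , w , a∈ , w∈′ , refl ← ∈-cartesianProductWith⁻ _∷_ L (words m L) (subst (_ ∈_) (words-suc m L) w∈)
    = Product.map (cong suc) (a∈ ∷_) (∈-words⁻ m L w∈′)

  ∈-words⁺ : ∀ m L {w} → length w ≡ m → All (_∈ L) w → w ∈ words m L
  ∈-words⁺ zero L {[]} refl [] = here refl
  ∈-words⁺ (suc m) L {a ∷ w} len (a∈ ∷ all) = subst (_ ∈_) (sym (words-suc m L))
    (∈-cartesianProductWith⁺ _∷_ a∈ (∈-words⁺ m L (ℕP.suc-injective len) all))

  words-unique : ∀ m L → Unique L → Unique (words m L)
  words-unique zero L _ = [] ∷ []
  words-unique (suc m) L L-unique = subst Unique (sym (words-suc m L))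
    (UniqueP.cartesianProductWith⁺ _∷_ LP.∷-injective L-unique (words-unique m L L-unique))

  ∈-Bn⁻ : ∀ k {γ} → γ ∈ Bn k → IsSignedPerm k γ
  ∈-Bn⁻ k γ∈ with γ∈words , γ-unique ← ∈-filter⁻ (λ γ → unique? (map ∣_∣ γ)) {xs = words k (signedRange k)} γ∈
    = Product.map₂ (λ all → All.map ∈-signedRange⁻ all , γ-unique) (∈-words⁻ k (signedRange k) γ∈words)

  ∈-Bn⁺ : ∀ k {γ} → IsSignedPerm k γ → γ ∈ Bn k
  ∈-Bn⁺ k (len , letters , γ-unique) = ∈-filter⁺ (λ γ → unique? (map ∣_∣ γ))
    (∈-words⁺ k (signedRange k) len (All.map ∈-signedRange⁺ letters)) γ-unique

  Bn-unique : ∀ k → Unique (Bn k)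
  Bn-unique k = UniqueP.filter⁺ (λ γ → unique? (map ∣_∣ γ)) (words-unique k (signedRange k) (signedRange-unique k))

  letterIndex : ℤ → ℕ
  letterIndex a = ℕ.pred ∣ a ∣

  ∣letter∣≡suc-index : ∀ a → 0 < ∣ a ∣ → ∣ a ∣ ≡ suc (letterIndex a)
  ∣letter∣≡suc-index a 0<∣a∣ = sym (suc-pred-of-pos 0<∣a∣)

  insertLast : ℤ → List ℤ → List ℤ
  insertLast a γ = map (liftLetter (letterIndex a)) γ ∷ʳ a

  insertLast-injective : ∀ {a b γ δ} → insertLast a γ ≡ insertLast b δ → a ≡ b × γ ≡ δ
  insertLast-injective {a} {b} {γ} {δ} eq with LP.∷ʳ-injective (map _ γ) (map _ δ) eq
  ... | maps≡ , refl = refl , LP.map-injective (liftLetter-injective (letterIndex a)) maps≡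

  isSignedPerm-insertLast : ∀ k {a γ} → IsLetter (suc k) a → IsSignedPerm k γ →
    IsSignedPerm (suc k) (insertLast a γ)
  isSignedPerm-insertLast k {a} {γ} a-letter (len , letters , γ-unique) = length≡ , letters′ , unique′
    where
    p = letterIndex a
    length≡ : length (insertLast a γ) ≡ suc k
    length≡ = trans (LP.length-++ (map (liftLetter p) γ))
      (trans (cong (ℕ._+ 1) (trans (LP.length-map _ γ) len)) (ℕP.+-comm k 1))
    letters′ : All (IsLetter (suc k)) (insertLast a γ)
    letters′ = AllP.∷ʳ⁺ (AllP.map⁺ (All.map (λ {v} → liftLetter-isLetter p {k} {v}) letters)) a-letter
    avoids-a : Disjoint (map (shiftAbove p) (map ∣_∣ γ)) (∣ a ∣ ∷ [])
    avoids-a (v∈ , here refl) with x , _ , v≡ ← ∈-map⁻ _ v∈ =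
      shiftAbove-≢ p x (trans (sym v≡) (∣letter∣≡suc-index a (proj₁ a-letter)))
    unique′ : Unique (map ∣_∣ (insertLast a γ))
    unique′ rewrite LP.map-++ ∣_∣ (map (liftLetter p) γ) (a ∷ []) | map-∣liftLetter∣ p γ =
      UniqueP.++⁺ (UniqueP.map⁺ (shiftAbove-injective p) γ-unique) ([] ∷ []) avoids-a

  removeLast : ∀ k {γ} → IsSignedPerm (suc k) γ →
    ∃₂ λ a δ → IsLetter (suc k) a × IsSignedPerm k δ × γ ≡ insertLast a δ
  removeLast k {γ} perm with initLast γ
  removeLast k (() , _) | []
  removeLast k (len , letters , γ-unique) | xs ∷ʳ′ a =
    a , map (lowerLetter p) xs , a-letter , (length′ , letters′ , unique′) , cong (_∷ʳ a) (sym lift∘lower)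
    where
    p = letterIndex a
    xs-letters : All (IsLetter (suc k)) xs
    xs-letters = proj₁ (AllP.∷ʳ⁻ letters)
    a-letter : IsLetter (suc k) a
    a-letter = proj₂ (AllP.∷ʳ⁻ letters)
    ∣a∣≡ : ∣ a ∣ ≡ suc p
    ∣a∣≡ = ∣letter∣≡suc-index a (proj₁ a-letter)
    xs-unique×avoids : Unique (map ∣_∣ xs) × All (_≢ ∣ a ∣) (map ∣_∣ xs)
    xs-unique×avoids = unique-∷ʳ⁻ (map ∣_∣ xs) (subst Unique (LP.map-++ ∣_∣ xs (a ∷ [])) γ-unique)
    avoids : All (λ v → ∣ v ∣ ≢ suc p) xs
    avoids = All.map (λ ne e → ne (trans e (sym ∣a∣≡))) (AllP.map⁻ (proj₂ xs-unique×avoids))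
    p≤k : p ≤ k
    p≤k = ℕP.≤-pred (subst (_≤ suc k) ∣a∣≡ (proj₂ a-letter))
    lift∘lower : map (liftLetter p) (map (lowerLetter p) xs) ≡ xs
    lift∘lower = trans (sym (LP.map-∘ xs)) (trans (LP.map-cong-local (All.zipWith
      (λ {v} (v-letter , ne) → liftLetter-lowerLetter p v (proj₁ v-letter) ne) (xs-letters , avoids))) (LP.map-id xs))
    length′ : length (map (lowerLetter p) xs) ≡ k
    length′ = trans (LP.length-map _ xs) (ℕP.suc-injective
      (trans (ℕP.+-comm 1 (length xs)) (trans (sym (LP.length-++ xs)) len)))
    letters′ : All (IsLetter k) (map (lowerLetter p) xs)
    letters′ = AllP.map⁺ (All.zipWith
      (λ {v} (v-letter , ne) → lowerLetter-isLetter p k v v-letter ne p≤k) (xs-letters , avoids))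
    unique′ : Unique (map ∣_∣ (map (lowerLetter p) xs))
    unique′ = UniqueP.map⁻ (subst Unique
      (trans (cong (map ∣_∣) (sym lift∘lower)) (map-∣liftLetter∣ p _)) (proj₁ xs-unique×avoids))

  Bn-suc↭ : ∀ k → Bn (suc k) ↭ cartesianProductWith insertLast (signedRange (suc k)) (Bn k)
  Bn-suc↭ k = ∼bag⇒↭ (unique∧set⇒bag (Bn-unique (suc k)) insertions-unique (mk⇔ to from))
    where
    insertions-unique : Unique (cartesianProductWith insertLast (signedRange (suc k)) (Bn k))
    insertions-unique = UniqueP.cartesianProductWith⁺ insertLast insertLast-injective
      (signedRange-unique (suc k)) (Bn-unique k)
    to : ∀ {γ} → γ ∈ Bn (suc k) → γ ∈ cartesianProductWith insertLast (signedRange (suc k)) (Bn k)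
    to γ∈ with a , δ , a-letter , δ-perm , refl ← removeLast k (∈-Bn⁻ (suc k) γ∈) =
      ∈-cartesianProductWith⁺ insertLast (∈-signedRange⁺ a-letter) (∈-Bn⁺ k δ-perm)
    from : ∀ {γ} → γ ∈ cartesianProductWith insertLast (signedRange (suc k)) (Bn k) → γ ∈ Bn (suc k)
    from γ∈ with a , δ , a∈ , δ∈ , refl ← ∈-cartesianProductWith⁻ insertLast _ _ γ∈ =
      ∈-Bn⁺ (suc k) (isSignedPerm-insertLast k (∈-signedRange⁻ a∈) (∈-Bn⁻ k δ∈))

  length-filter-< : ∀ a w → length (filter (ℤP._<? a) w) ≡ count (λ b → ⌊ b ℤP.<? a ⌋) w
  length-filter-< a [] = refl
  length-filter-< a (x ∷ w) with x ℤP.<? a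
  ... | yes _ = cong suc (length-filter-< a w)
  ... | no _ = length-filter-< a w

  liftLetter-mono-< : ∀ p {x y} → x ℤ.< y → liftLetter p x ℤ.< liftLetter p y
  liftLetter-mono-< p (ℤ.-<- {m} {n} n<m) =
    ℤ.-<- (ℕP.pred-mono-< {{ℕ.>-nonZero (shiftAbove-suc-pos p n)}} (shiftAbove-mono-< p (s≤s n<m)))
  liftLetter-mono-< p ℤ.-<+ = ℤ.-<+
  liftLetter-mono-< p (ℤ.+<+ x<y) = ℤ.+<+ (shiftAbove-mono-< p x<y)

  liftLetter-cancel-< : ∀ p {x y} → liftLetter p x ℤ.< liftLetter p y → x ℤ.< y
  liftLetter-cancel-< p {+ x} {+ y} (ℤ.+<+ lt) = ℤ.+<+ (shiftAbove-cancel-< p lt)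
  liftLetter-cancel-< p { -[1+ x ] } {+ y} _ = ℤ.-<+
  liftLetter-cancel-< p { -[1+ x ] } { -[1+ y ] } (ℤ.-<- lt) =
    ℤ.-<- (ℕP.≤-pred (shiftAbove-cancel-< p (ℕP.pred-cancel-< lt)))

  liftLetter-≺ : ∀ p x y → (liftLetter p x ≺ liftLetter p y) ≡ (x ≺ y)
  liftLetter-≺ p (+ x) (+ y) = isYes-⇔ (_ ℕ.<? _) (x ℕ.<? y) (mk⇔ (shiftAbove-cancel-< p) (shiftAbove-mono-< p))
  liftLetter-≺ p (+ x) -[1+ y ] = refl
  liftLetter-≺ p -[1+ x ] (+ y) = refl
  liftLetter-≺ p -[1+ x ] -[1+ y ] = isYes-⇔ (_ ℕ.<? _) (x ℕ.<? y) (mk⇔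
    (λ lt → ℕP.≤-pred (shiftAbove-cancel-< p (ℕP.pred-cancel-< lt)))
    (λ lt → ℕP.pred-mono-< {{ℕ.>-nonZero (shiftAbove-suc-pos p x)}} (shiftAbove-mono-< p (s≤s lt))))

  inv-liftLetter : ∀ p w → inv (map (liftLetter p) w) ≡ inv w
  inv-liftLetter p [] = refl
  inv-liftLetter p (x ∷ w) = cong₂ ℕ._+_ smaller≡ (inv-liftLetter p w)
    where
    open ≡-Reasoning
    smaller≡ : length (filter (ℤP._<? liftLetter p x) (map (liftLetter p) w)) ≡ length (filter (ℤP._<? x) w)
    smaller≡ = begin
      length (filter (ℤP._<? liftLetter p x) (map (liftLetter p) w)) ≡⟨ length-filter-< (liftLetter p x) (map (liftLetter p) w) ⟩
      count (λ b → ⌊ b ℤP.<? liftLetter p x ⌋) (map (liftLetter p) w) ≡⟨ count-map _ (liftLetter p) w ⟩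
      count (λ b → ⌊ liftLetter p b ℤP.<? liftLetter p x ⌋) w
        ≡⟨ count-cong (λ b → isYes-⇔ _ (b ℤP.<? x) (mk⇔ (liftLetter-cancel-< p) (liftLetter-mono-< p))) w ⟩
      count (λ b → ⌊ b ℤP.<? x ⌋) w ≡⟨ length-filter-< x w ⟨
      length (filter (ℤP._<? x) w) ∎

  inv-∷ʳ : ∀ w a → inv (w ∷ʳ a) ≡ inv w ℕ.+ count (λ x → ⌊ a ℤP.<? x ⌋) w
  inv-∷ʳ [] a = refl
  inv-∷ʳ (x ∷ w) a = begin
    length (filter (ℤP._<? x) (w ∷ʳ a)) ℕ.+ inv (w ∷ʳ a)
      ≡⟨ cong₂ ℕ._+_ (trans (length-filter-< x (w ∷ʳ a)) (count-++ _ w (a ∷ []))) (inv-∷ʳ w a) ⟩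
    (count (λ b → ⌊ b ℤP.<? x ⌋) w ℕ.+ (indicator ⌊ a ℤP.<? x ⌋ ℕ.+ 0)) ℕ.+ (inv w ℕ.+ count (λ y → ⌊ a ℤP.<? y ⌋) w)
      ≡⟨ +-interchange (count (λ b → ⌊ b ℤP.<? x ⌋) w) _ _ _ ⟩
    (count (λ b → ⌊ b ℤP.<? x ⌋) w ℕ.+ inv w) ℕ.+ ((indicator ⌊ a ℤP.<? x ⌋ ℕ.+ 0) ℕ.+ count (λ y → ⌊ a ℤP.<? y ⌋) w)
      ≡⟨ cong₂ ℕ._+_ (cong (ℕ._+ inv w) (sym (length-filter-< x w)))
                     (cong (ℕ._+ count (λ y → ⌊ a ℤP.<? y ⌋) w) (ℕP.+-identityʳ _)) ⟩
    inv (x ∷ w) ℕ.+ count (λ y → ⌊ a ℤP.<? y ⌋) (x ∷ w) ∎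
    where open ≡-Reasoning

  negAbsSum-++ : ∀ xs ys → negAbsSum (xs ++ ys) ≡ negAbsSum xs ℕ.+ negAbsSum ys
  negAbsSum-++ [] ys = refl
  negAbsSum-++ (+ _ ∷ xs) ys = negAbsSum-++ xs ys
  negAbsSum-++ (-[1+ k ] ∷ xs) ys = trans (cong (suc k ℕ.+_) (negAbsSum-++ xs ys)) (sym (ℕP.+-assoc (suc k) _ _))

  negCount-++ : ∀ xs ys → negCount (xs ++ ys) ≡ negCount xs ℕ.+ negCount ys
  negCount-++ [] ys = refl
  negCount-++ (+ _ ∷ xs) ys = negCount-++ xs ys
  negCount-++ (-[1+ k ] ∷ xs) ys = cong suc (negCount-++ xs ys)

  negCount-liftLetter : ∀ p w → negCount (map (liftLetter p) w) ≡ negCount w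
  negCount-liftLetter p [] = refl
  negCount-liftLetter p (+ _ ∷ w) = negCount-liftLetter p w
  negCount-liftLetter p (-[1+ _ ] ∷ w) = cong suc (negCount-liftLetter p w)

  isShiftedNegative : ℕ → ℤ → Bool
  isShiftedNegative p (+ _) = false
  isShiftedNegative p -[1+ v ] = ⌊ p ℕ.≤? v ⌋

  negAbsSum-liftLetter : ∀ p w → negAbsSum (map (liftLetter p) w) ≡ negAbsSum w ℕ.+ count (isShiftedNegative p) w
  negAbsSum-liftLetter p [] = refl
  negAbsSum-liftLetter p (+ _ ∷ w) = negAbsSum-liftLetter p w
  negAbsSum-liftLetter p (-[1+ v ] ∷ w) = begin
    suc (ℕ.pred (shiftAbove p (suc v))) ℕ.+ negAbsSum (map (liftLetter p) w)
      ≡⟨ cong₂ ℕ._+_ (trans (suc-pred-of-pos (shiftAbove-suc-pos p v)) (shiftAbove-suc p v)) (negAbsSum-liftLetter p w) ⟩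
    (suc v ℕ.+ indicator ⌊ p ℕ.≤? v ⌋) ℕ.+ (negAbsSum w ℕ.+ count (isShiftedNegative p) w)
      ≡⟨ +-interchange (suc v) _ _ _ ⟩
    (suc v ℕ.+ negAbsSum w) ℕ.+ (indicator ⌊ p ℕ.≤? v ⌋ ℕ.+ count (isShiftedNegative p) w) ∎
    where open ≡-Reasoning

  count-∣∣≤ : ∀ k {γ} → IsSignedPerm k γ → ∀ P → P ≤ k → count (λ v → ⌊ ∣ v ∣ ℕ.≤? P ⌋) γ ≡ P
  count-∣∣≤ zero {[]} _ .zero z≤n = refl
  count-∣∣≤ (suc k) perm P P≤
    with a , δ , a-letter , δ-perm , refl ← removeLast k perm = begin
    count (λ v → ⌊ ∣ v ∣ ℕ.≤? P ⌋) (map (liftLetter p) δ ∷ʳ a)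
      ≡⟨ count-++ _ (map (liftLetter p) δ) (a ∷ []) ⟩
    count (λ v → ⌊ ∣ v ∣ ℕ.≤? P ⌋) (map (liftLetter p) δ) ℕ.+ (indicator ⌊ ∣ a ∣ ℕ.≤? P ⌋ ℕ.+ 0)
      ≡⟨ cong₂ ℕ._+_ (trans (count-map _ (liftLetter p) δ) (count-cong (λ v → cong (λ x → ⌊ x ℕ.≤? P ⌋) (∣liftLetter∣ p v)) δ))
                     (trans (ℕP.+-identityʳ _) (cong (λ x → indicator ⌊ x ℕ.≤? P ⌋) ∣a∣≡)) ⟩
    count (λ v → ⌊ shiftAbove p ∣ v ∣ ℕ.≤? P ⌋) δ ℕ.+ indicator ⌊ suc p ℕ.≤? P ⌋
      ≡⟨ by-position-of-a P P≤ ⟩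
    P ∎
    where
    open ≡-Reasoning
    p = letterIndex a
    ∣a∣≡ : ∣ a ∣ ≡ suc p
    ∣a∣≡ = ∣letter∣≡suc-index a (proj₁ a-letter)
    p≤k : p ≤ k
    p≤k = ℕP.≤-pred (subst (_≤ suc k) ∣a∣≡ (proj₂ a-letter))
    by-position-of-a : ∀ P → P ≤ suc k → count (λ v → ⌊ shiftAbove p ∣ v ∣ ℕ.≤? P ⌋) δ ℕ.+ indicator ⌊ suc p ℕ.≤? P ⌋ ≡ P
    by-position-of-a P P≤ with P ℕ.≤? p
    ... | yes P≤p = trans (cong₂ ℕ._+_
            (trans (count-cong (λ v → isYes-⇔ _ _ (shiftAbove-≤-low (∣ v ∣) P≤p)) δ) (count-∣∣≤ k δ-perm P (ℕP.≤-trans P≤p p≤k)))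
            (cong indicator (isYes-false (suc p ℕ.≤? P) (ℕP.<⇒≱ (s≤s P≤p)))))
          (ℕP.+-identityʳ P)
    by-position-of-a zero _ | no P≰p = ⊥-elim (P≰p z≤n)
    by-position-of-a (suc P′) P≤ | no P≰p = trans (cong₂ ℕ._+_
            (trans (count-cong (λ v → isYes-⇔ _ _ (shiftAbove-≤-high (∣ v ∣) (ℕP.≤-pred (ℕP.≰⇒> P≰p)))) δ)
                   (count-∣∣≤ k δ-perm P′ (ℕP.≤-pred P≤)))
            (cong indicator (isYes-true (suc p ℕ.≤? suc P′) (ℕP.≰⇒> P≰p))))
          (ℕP.+-comm P′ 1)

  count-∣∣> : ∀ k {γ} → IsSignedPerm k γ → ∀ j d → j ℕ.+ d ≡ k → count (λ v → ⌊ j ℕ.<? ∣ v ∣ ⌋) γ ≡ d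
  count-∣∣> k {γ} perm j d j+d≡k = ℕP.+-cancelʳ-≡ j _ d (begin
    count (λ v → ⌊ j ℕ.<? ∣ v ∣ ⌋) γ ℕ.+ j
      ≡⟨ cong (count (λ v → ⌊ j ℕ.<? ∣ v ∣ ⌋) γ ℕ.+_) (count-∣∣≤ k perm j (subst (j ℕ.≤_) j+d≡k (ℕP.m≤m+n j d))) ⟨
    count (λ v → ⌊ j ℕ.<? ∣ v ∣ ⌋) γ ℕ.+ count (λ v → ⌊ ∣ v ∣ ℕ.≤? j ⌋) γ
      ≡⟨ count-+ _ _ (λ _ → true) above-or-below γ ⟩
    count (λ _ → true) γ ≡⟨ trans (count-true γ) (proj₁ perm) ⟩
    k ≡⟨ trans (sym j+d≡k) (ℕP.+-comm j d) ⟩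
    d ℕ.+ j ∎)
    where
    open ≡-Reasoning
    above-or-below : ∀ v → indicator ⌊ j ℕ.<? ∣ v ∣ ⌋ ℕ.+ indicator ⌊ ∣ v ∣ ℕ.≤? j ⌋ ≡ 1
    above-or-below v with j ℕ.<? ∣ v ∣ | ∣ v ∣ ℕ.≤? j
    ... | yes j<v | yes v≤j = ⊥-elim (ℕP.<⇒≱ j<v v≤j)
    ... | yes _ | no _ = refl
    ... | no _ | yes _ = refl
    ... | no j≮v | no v≰j = ⊥-elim (j≮v (ℕP.≰⇒> v≰j))

  inv-insertLast : ∀ a γ → inv (insertLast a γ) ≡ inv γ ℕ.+ count (λ v → ⌊ a ℤP.<? liftLetter (letterIndex a) v ⌋) γ
  inv-insertLast a γ = trans (inv-∷ʳ (map (liftLetter (letterIndex a)) γ) a)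
    (cong₂ ℕ._+_ (inv-liftLetter (letterIndex a) γ) (count-map _ (liftLetter (letterIndex a)) γ))

  ℓB-insertLast : ∀ a γ → ℓB (insertLast a γ) ≡
    ℓB γ ℕ.+ (count (λ v → ⌊ a ℤP.<? liftLetter (letterIndex a) v ⌋) γ ℕ.+ count (isShiftedNegative (letterIndex a)) γ)
      ℕ.+ negAbsSum (a ∷ [])
  ℓB-insertLast a γ = begin
    inv (insertLast a γ) ℕ.+ negAbsSum (map (liftLetter p) γ ∷ʳ a)
      ≡⟨ cong₂ ℕ._+_ (inv-insertLast a γ)
                     (trans (negAbsSum-++ (map (liftLetter p) γ) (a ∷ [])) (cong (ℕ._+ negAbsSum (a ∷ [])) (negAbsSum-liftLetter p γ))) ⟩
    (inv γ ℕ.+ larger) ℕ.+ ((negAbsSum γ ℕ.+ shifted) ℕ.+ negAbsSum (a ∷ []))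
      ≡⟨ ℕP.+-assoc (inv γ ℕ.+ larger) _ _ ⟨
    ((inv γ ℕ.+ larger) ℕ.+ (negAbsSum γ ℕ.+ shifted)) ℕ.+ negAbsSum (a ∷ [])
      ≡⟨ cong (ℕ._+ negAbsSum (a ∷ [])) (+-interchange (inv γ) _ _ _) ⟩
    ℓB γ ℕ.+ (larger ℕ.+ shifted) ℕ.+ negAbsSum (a ∷ []) ∎
    where
    open ≡-Reasoning
    p = letterIndex a
    larger = count (λ v → ⌊ a ℤP.<? liftLetter p v ⌋) γ
    shifted = count (isShiftedNegative p) γ

  ℓB-insertLast-pos : ∀ k {γ} → IsSignedPerm k γ → ∀ j d → j ℕ.+ d ≡ k →
    ℓB (insertLast (+ suc j) γ) ≡ ℓB γ ℕ.+ d
  ℓB-insertLast-pos k {γ} perm j d j+d≡k = trans (ℓB-insertLast (+ suc j) γ) (trans (ℕP.+-identityʳ _)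
    (cong (ℓB γ ℕ.+_) (trans (count-+ _ _ _ larger-or-shifted γ) (count-∣∣> k perm j d j+d≡k))))
    where
    larger-or-shifted : ∀ v → indicator ⌊ + suc j ℤP.<? liftLetter j v ⌋ ℕ.+ indicator (isShiftedNegative j v)
                            ≡ indicator ⌊ j ℕ.<? ∣ v ∣ ⌋
    larger-or-shifted (+ y) = trans (ℕP.+-identityʳ _) (cong indicator (isYes-⇔ _ (j ℕ.<? y) (mk⇔ from to)))
      where
      from : + suc j ℤ.< + shiftAbove j y → j < y
      from (ℤ.+<+ lt) with y ℕ.≤? j
      ... | yes y≤j = ⊥-elim (ℕP.<⇒≱ lt (ℕP.m≤n⇒m≤1+n y≤j))
      ... | no y≰j = ℕP.≰⇒> y≰j
      to : j < y → + suc j ℤ.< + shiftAbove j y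
      to j<y = ℤ.+<+ (subst (suc j <_) (sym (shiftAbove-> j<y)) (s≤s j<y))
    larger-or-shifted -[1+ y ] = cong₂ ℕ._+_
      (cong indicator (isYes-false (+ suc j ℤP.<? liftLetter j -[1+ y ]) λ ()))
      (cong indicator (isYes-⇔ (j ℕ.≤? y) (j ℕ.<? suc y) (mk⇔ s≤s ℕP.≤-pred)))

  ℓB-insertLast-neg : ∀ k {γ} → IsSignedPerm k γ → ∀ j → ℓB (insertLast -[1+ j ] γ) ≡ ℓB γ ℕ.+ (k ℕ.+ suc j)
  ℓB-insertLast-neg k {γ} perm j = trans (ℓB-insertLast -[1+ j ] γ) (trans (ℕP.+-assoc (ℓB γ) _ _)
    (cong (ℓB γ ℕ.+_) (cong₂ ℕ._+_
      (trans (count-+ _ _ (λ _ → true) larger-xor-shifted γ) (trans (count-true γ) (proj₁ perm)))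
      (ℕP.+-identityʳ (suc j)))))
    where
    larger-xor-shifted : ∀ v → indicator ⌊ -[1+ j ] ℤP.<? liftLetter j v ⌋ ℕ.+ indicator (isShiftedNegative j v) ≡ 1
    larger-xor-shifted (+ y) = cong (λ b → indicator b ℕ.+ 0) (isYes-true (-[1+ j ] ℤP.<? + shiftAbove j y) ℤ.-<+)
    larger-xor-shifted -[1+ y ] with j ℕ.≤? y
    ... | yes j≤y = cong (ℕ._+ 1) (cong indicator (isYes-false (-[1+ j ] ℤP.<? -[1+ _ ])
          λ { (ℤ.-<- lt) → ℕP.<⇒≱ lt (subst (j ℕ.≤_) (sym (cong ℕ.pred (shiftAbove-> (s≤s j≤y)))) (ℕP.m≤n⇒m≤1+n j≤y)) }))
    ... | no j≰y = cong (ℕ._+ 0) (cong indicator (isYes-true (-[1+ j ] ℤP.<? -[1+ _ ])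
          (ℤ.-<- (subst (_< j) (sym (cong ℕ.pred (shiftAbove-≤ (ℕP.≰⇒> j≰y)))) (ℕP.≰⇒> j≰y)))))

  ≺-liftLetter-pos : ∀ j i → ((+ suc j) ≺ liftLetter j (+ suc i)) ≡ ⌊ j ℕ.≤? i ⌋
  ≺-liftLetter-pos j i with j ℕ.≤? i
  ... | yes j≤i rewrite shiftAbove-> {j} {suc i} (s≤s j≤i) = isYes-true (suc j ℕ.<? suc (suc i)) (s≤s (s≤s j≤i))
  ... | no j≰i rewrite shiftAbove-≤ {j} {suc i} (ℕP.≰⇒> j≰i) =
    isYes-false (suc j ℕ.<? suc i) (λ lt → j≰i (ℕP.<⇒≤ (ℕP.≤-pred lt)))

  ≺-liftLetter-neg : ∀ j i → (-[1+ j ] ≺ liftLetter j -[1+ i ]) ≡ ⌊ j ℕ.≤? i ⌋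
  ≺-liftLetter-neg j i with j ℕ.≤? i
  ... | yes j≤i rewrite shiftAbove-> {j} {suc i} (s≤s j≤i) = isYes-true (j ℕ.<? suc i) (s≤s j≤i)
  ... | no j≰i rewrite shiftAbove-≤ {j} {suc i} (ℕP.≰⇒> j≰i) = isYes-false (j ℕ.<? i) (λ lt → j≰i (ℕP.<⇒≤ lt))

  majFrom-liftLetter : ∀ p i w → majFrom i (map (liftLetter p) w) ≡ majFrom i w
  majFrom-liftLetter p i [] = refl
  majFrom-liftLetter p i (x ∷ []) = refl
  majFrom-liftLetter p i (x ∷ y ∷ w) =
    cong₂ ℕ._+_ (cong (λ b → if b then i else 0) (liftLetter-≺ p y x)) (majFrom-liftLetter p (suc i) (y ∷ w))

  descentAt : ℤ → ℤ → ℕ → ℕ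
  descentAt a b i = if a ≺ b then i else 0

  majFrom-step : ∀ c m a b i n →
    c ℕ.+ (m ℕ.+ descentAt a b (suc i ℕ.+ n)) ≡ (c ℕ.+ m) ℕ.+ descentAt a b (i ℕ.+ suc n)
  majFrom-step c m a b i n = trans (sym (ℕP.+-assoc c m _)) (cong (λ k → (c ℕ.+ m) ℕ.+ descentAt a b k) (sym (ℕP.+-suc i n)))

  majFrom-∷ʳ-∷ʳ : ∀ i ys b a → majFrom i (ys ∷ʳ b ∷ʳ a) ≡ majFrom i (ys ∷ʳ b) ℕ.+ descentAt a b (i ℕ.+ length ys)
  majFrom-∷ʳ-∷ʳ i [] b a with a ≺ b
  ... | true = refl
  ... | false = refl
  majFrom-∷ʳ-∷ʳ i (y ∷ []) b a =
    trans (cong (descentAt b y i ℕ.+_) (majFrom-∷ʳ-∷ʳ (suc i) [] b a)) (majFrom-step (descentAt b y i) 0 a b i 0)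
  majFrom-∷ʳ-∷ʳ i (y ∷ z ∷ ys) b a =
    trans (cong (descentAt z y i ℕ.+_) (majFrom-∷ʳ-∷ʳ (suc i) (z ∷ ys) b a))
          (majFrom-step (descentAt z y i) _ a b i (length (z ∷ ys)))

  fmaj-rearrange : ∀ m d n e → 2 ℕ.* (m ℕ.+ d) ℕ.+ (n ℕ.+ e) ≡ 2 ℕ.* m ℕ.+ n ℕ.+ 2 ℕ.* d ℕ.+ e
  fmaj-rearrange = solve-∀

  fmaj-insertLast : ∀ a ys b → fmaj (insertLast a (ys ∷ʳ b)) ≡
    fmaj (ys ∷ʳ b) ℕ.+ 2 ℕ.* descentAt a (liftLetter (letterIndex a) b) (suc (length ys)) ℕ.+ negCount (a ∷ [])
  fmaj-insertLast a ys b = begin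
    2 ℕ.* majFrom 1 (map ℓ (ys ∷ʳ b) ∷ʳ a) ℕ.+ negCount (map ℓ (ys ∷ʳ b) ∷ʳ a)
      ≡⟨ cong (λ w → 2 ℕ.* majFrom 1 (w ∷ʳ a) ℕ.+ negCount (w ∷ʳ a)) (LP.map-++ ℓ ys (b ∷ [])) ⟩
    2 ℕ.* majFrom 1 (map ℓ ys ∷ʳ ℓ b ∷ʳ a) ℕ.+ negCount (map ℓ ys ∷ʳ ℓ b ∷ʳ a)
      ≡⟨ cong₂ (λ m n → 2 ℕ.* m ℕ.+ n) (majFrom-∷ʳ-∷ʳ 1 (map ℓ ys) (ℓ b) a) (negCount-++ (map ℓ ys ∷ʳ ℓ b) (a ∷ [])) ⟩
    2 ℕ.* (majFrom 1 (map ℓ ys ∷ʳ ℓ b) ℕ.+ descentAt a (ℓ b) (suc (length (map ℓ ys))))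
      ℕ.+ (negCount (map ℓ ys ∷ʳ ℓ b) ℕ.+ negCount (a ∷ []))
      ≡⟨ cong₂ (λ m n → 2 ℕ.* (m ℕ.+ descentAt a (ℓ b) (suc (length (map ℓ ys)))) ℕ.+ (n ℕ.+ negCount (a ∷ [])))
               (trans (cong (majFrom 1) (sym (LP.map-++ ℓ ys (b ∷ [])))) (majFrom-liftLetter p 1 (ys ∷ʳ b)))
               (trans (cong negCount (sym (LP.map-++ ℓ ys (b ∷ [])))) (negCount-liftLetter p (ys ∷ʳ b))) ⟩
    2 ℕ.* (maj≺ (ys ∷ʳ b) ℕ.+ descentAt a (ℓ b) (suc (length (map ℓ ys)))) ℕ.+ (negCount (ys ∷ʳ b) ℕ.+ negCount (a ∷ []))
      ≡⟨ fmaj-rearrange (maj≺ (ys ∷ʳ b)) _ _ _ ⟩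
    fmaj (ys ∷ʳ b) ℕ.+ 2 ℕ.* descentAt a (ℓ b) (suc (length (map ℓ ys))) ℕ.+ negCount (a ∷ [])
      ≡⟨ cong (λ n → fmaj (ys ∷ʳ b) ℕ.+ 2 ℕ.* descentAt a (ℓ b) (suc n) ℕ.+ negCount (a ∷ [])) (LP.length-map ℓ ys) ⟩
    fmaj (ys ∷ʳ b) ℕ.+ 2 ℕ.* descentAt a (ℓ b) (suc (length ys)) ℕ.+ negCount (a ∷ []) ∎
    where
    open ≡-Reasoning
    p = letterIndex a
    ℓ = liftLetter p

  lastLetterCond : ℕ → ℤ → Bool
  lastLetterCond n (+ k) = ⌊ 0 ℕ.<? k ⌋ ∧ ⌊ k ℕ.<? n ⌋
  lastLetterCond n -[1+ _ ] = false

  lastCond-∷ʳ : ∀ n xs a → lastCond n (xs ∷ʳ a) ≡ lastLetterCond n a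
  lastCond-∷ʳ n xs a with last (xs ∷ʳ a) | last-∷ʳ xs a
  ... | .(just a) | refl with a
  ...   | + k = refl
  ...   | -[1+ k ] = refl

open SignedPermutations

module RingSums {c ℓ} (R : CommutativeRing c ℓ) where
  open CommutativeRing R
  open RingDefs R
  open import Relation.Binary.Reasoning.Setoid setoid

  ∑ : {A : Set} → List A → (A → Carrier) → Carrier
  ∑ xs f = sumR (map f xs)

  ∑-map : ∀ {A B : Set} (g : A → B) xs f → ∑ (map g xs) f ≡ ∑ xs (f ∘ g)
  ∑-map g xs f = ≡.cong sumR (≡.sym (LP.map-∘ xs))

  ∑-++ : ∀ {A : Set} (xs ys : List A) f → ∑ (xs ++ ys) f ≈ ∑ xs f + ∑ ys f
  ∑-++ [] ys f = sym (+-identityˡ _)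
  ∑-++ (x ∷ xs) ys f = trans (+-congˡ (∑-++ xs ys f)) (sym (+-assoc _ _ _))

  ∑-cartesianProductWith : ∀ {A B C : Set} (g : A → B → C) xs ys f →
    ∑ (cartesianProductWith g xs ys) f ≈ ∑ xs (λ x → ∑ ys (f ∘ g x))
  ∑-cartesianProductWith g [] ys f = refl
  ∑-cartesianProductWith g (x ∷ xs) ys f = trans (∑-++ (map (g x) ys) _ f)
    (+-cong (reflexive (∑-map (g x) ys f)) (∑-cartesianProductWith g xs ys f))

  ∑-↭ : ∀ {A : Set} {xs ys : List A} f → xs ↭ ys → ∑ xs f ≈ ∑ ys f
  ∑-↭ f xs↭ys = PermSetoidP.foldr-commMonoid setoid +-isCommutativeMonoid
    (↭⇒↭ₛ′ isEquivalence (PermP.map⁺ f xs↭ys))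

  ∑-cong : ∀ {A : Set} (xs : List A) {f g} → (∀ {x} → x ∈ xs → f x ≈ g x) → ∑ xs f ≈ ∑ xs g
  ∑-cong [] f≈g = refl
  ∑-cong (x ∷ xs) f≈g = +-cong (f≈g (here ≡.refl)) (∑-cong xs (f≈g ∘ there))

  ∑-*ˡ : ∀ {A : Set} (xs : List A) a f → ∑ xs (λ x → a * f x) ≈ a * ∑ xs f
  ∑-*ˡ [] a f = sym (zeroʳ a)
  ∑-*ˡ (x ∷ xs) a f = trans (+-congˡ (∑-*ˡ xs a f)) (sym (distribˡ a _ _))

  ∑-filter : ∀ {A : Set} {P : A → Set} (P? : ∀ x → Dec (P x)) xs f →
    ∑ (filter P? xs) f ≈ ∑ xs (λ x → if ⌊ P? x ⌋ then f x else 0#)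
  ∑-filter P? [] f = refl
  ∑-filter P? (x ∷ xs) f with P? x
  ... | yes _ = +-congˡ (∑-filter P? xs f)
  ... | no _ = trans (∑-filter P? xs f) (sym (+-identityˡ _))

  ∑-if : ∀ {A : Set} (b : Bool) (xs : List A) f → ∑ xs (λ x → if b then f x else 0#) ≈ (if b then ∑ xs f else 0#)
  ∑-if true xs f = refl
  ∑-if false [] f = refl
  ∑-if false (x ∷ xs) f = trans (+-identityˡ _) (∑-if false xs f)

  sumBelow : ℕ → (ℕ → Carrier) → Carrier
  sumBelow zero f = 0#
  sumBelow (suc n) f = sumBelow n f + f n

  prodBelow : ℕ → (ℕ → Carrier) → Carrier
  prodBelow zero f = 1#
  prodBelow (suc n) f = prodBelow n f * f n

  ∑-upTo : ∀ n f → ∑ (upTo n) f ≈ sumBelow n f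
  ∑-upTo zero f = refl
  ∑-upTo (suc n) f = begin
    ∑ (upTo (suc n)) f            ≡⟨ ≡.cong (λ l → ∑ l f) (LP.upTo-∷ʳ n) ⟨
    ∑ (upTo n ∷ʳ n) f             ≈⟨ ∑-++ (upTo n) (n ∷ []) f ⟩
    ∑ (upTo n) f + (f n + 0#)     ≈⟨ +-cong (∑-upTo n f) (+-identityʳ (f n)) ⟩
    sumBelow (suc n) f            ∎

  prodR-upTo : ∀ n f → prodR (map f (upTo n)) ≈ prodBelow n f
  prodR-upTo zero f = refl
  prodR-upTo (suc n) f = begin
    prodR (map f (upTo (suc n)))        ≡⟨ ≡.cong (λ l → prodR (map f l)) (LP.upTo-∷ʳ n) ⟨
    prodR (map f (upTo n ∷ʳ n))         ≡⟨ ≡.cong prodR (LP.map-++ f (upTo n) (n ∷ [])) ⟩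
    prodR (map f (upTo n) ++ f n ∷ [])  ≈⟨ prodR-++ (map f (upTo n)) ⟩
    prodR (map f (upTo n)) * (f n * 1#) ≈⟨ *-cong (prodR-upTo n f) (*-identityʳ (f n)) ⟩
    prodBelow (suc n) f                 ∎
    where
    prodR-++ : ∀ xs {ys} → prodR (xs ++ ys) ≈ prodR xs * prodR ys
    prodR-++ [] = sym (*-identityˡ _)
    prodR-++ (x ∷ xs) = trans (*-congˡ (prodR-++ xs)) (sym (*-assoc _ _ _))

  sumBelow-cong : ∀ n {f g} → (∀ i → i < n → f i ≈ g i) → sumBelow n f ≈ sumBelow n g
  sumBelow-cong zero f≈g = refl
  sumBelow-cong (suc n) f≈g = +-cong (sumBelow-cong n (λ i i<n → f≈g i (ℕP.m<n⇒m<1+n i<n))) (f≈g n ℕP.≤-refl)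

  prodBelow-cong : ∀ n {f g} → (∀ i → i < n → f i ≈ g i) → prodBelow n f ≈ prodBelow n g
  prodBelow-cong zero f≈g = refl
  prodBelow-cong (suc n) f≈g = *-cong (prodBelow-cong n (λ i i<n → f≈g i (ℕP.m<n⇒m<1+n i<n))) (f≈g n ℕP.≤-refl)

  sumBelow-0# : ∀ n → sumBelow n (λ _ → 0#) ≈ 0#
  sumBelow-0# zero = refl
  sumBelow-0# (suc n) = trans (+-identityʳ _) (sumBelow-0# n)

  sumBelow-*ˡ : ∀ n a f → sumBelow n (λ i → a * f i) ≈ a * sumBelow n f
  sumBelow-*ˡ zero a f = sym (zeroʳ a)
  sumBelow-*ˡ (suc n) a f = trans (+-congʳ (sumBelow-*ˡ n a f)) (sym (distribˡ a _ _))

  sumBelow-+ : ∀ m n f → sumBelow (m ℕ.+ n) f ≈ sumBelow m f + sumBelow n (λ i → f (m ℕ.+ i))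
  sumBelow-+ m zero f = trans (reflexive (≡.cong (λ k → sumBelow k f) (ℕP.+-identityʳ m))) (sym (+-identityʳ _))
  sumBelow-+ m (suc n) f = begin
    sumBelow (m ℕ.+ suc n) f ≡⟨ ≡.cong (λ k → sumBelow k f) (ℕP.+-suc m n) ⟩
    sumBelow (m ℕ.+ n) f + f (m ℕ.+ n) ≈⟨ +-congʳ (sumBelow-+ m n f) ⟩
    (sumBelow m f + sumBelow n (λ i → f (m ℕ.+ i))) + f (m ℕ.+ n) ≈⟨ +-assoc _ _ _ ⟩
    sumBelow m f + sumBelow (suc n) (λ i → f (m ℕ.+ i)) ∎

  sumBelow-reverse : ∀ n f → sumBelow n (λ i → f (n ℕ.∸ suc i)) ≈ sumBelow n f
  sumBelow-reverse zero f = refl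
  sumBelow-reverse (suc n) f = begin
    sumBelow n (λ i → f (n ℕ.∸ i)) + f (n ℕ.∸ n)
      ≈⟨ +-cong (sumBelow-cong n (λ i i<n → reflexive (≡.cong f (ℕP.+-∸-assoc 1 i<n)))) (reflexive (≡.cong f (ℕP.n∸n≡0 n))) ⟩
    sumBelow n (λ i → f (suc (n ℕ.∸ suc i))) + f 0 ≈⟨ +-congʳ (sumBelow-reverse n (f ∘ suc)) ⟩
    sumBelow n (f ∘ suc) + f 0                     ≈⟨ +-comm _ _ ⟩
    f 0 + sumBelow n (f ∘ suc)                     ≈⟨ sumBelow-suc n f ⟨
    sumBelow (suc n) f                             ∎
    where
    sumBelow-suc : ∀ n f → sumBelow (suc n) f ≈ f 0 + sumBelow n (f ∘ suc)
    sumBelow-suc n f = trans (sumBelow-+ 1 n f) (+-congʳ (+-identityˡ (f 0)))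

  ∑-signedRange : ∀ k f → ∑ (signedRange k) f ≈ sumBelow k (λ i → f -[1+ i ]) + sumBelow k (λ i → f (+ suc i))
  ∑-signedRange k f = begin
    ∑ (signedRange k) f ≈⟨ ∑-++ (map -[1+_] (upTo k)) (map (λ j → + suc j) (upTo k)) f ⟩
    ∑ (map -[1+_] (upTo k)) f + ∑ (map (λ j → + suc j) (upTo k)) f
      ≈⟨ +-cong (trans (reflexive (∑-map -[1+_] (upTo k) f)) (∑-upTo k _))
                (trans (reflexive (∑-map (λ j → + suc j) (upTo k) f)) (∑-upTo k _)) ⟩
    sumBelow k (λ i → f -[1+ i ]) + sumBelow k (λ i → f (+ suc i)) ∎

module QIntegers {c ℓ} (R : CommutativeRing c ℓ) where
  open CommutativeRing R
  open RingDefs R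
  open RingSums R
  open import Algebra.Definitions.RawSemiring (Algebra.Bundles.Semiring.rawSemiring semiring) using (_^_)
  open import Algebra.Properties.Semiring.Exp semiring using (^-homo-*; ^-congˡ)
  open import Algebra.Properties.CommutativeSemiring.Exp commutativeSemiring using (^-distrib-*)
  open import Algebra.Solver.Ring.NaturalCoefficients.Default commutativeSemiring using (solve; _:+_; _:*_; _:=_; con)
  open import Algebra.Properties.Ring ring using (-1*x≈-x; -‿involutive)
  open import Relation.Binary.Reasoning.Setoid setoid

  []≈sumBelow : ∀ m x → [ m ] x ≈ sumBelow m (x ^_)
  []≈sumBelow m x = trans (reflexive (foldr≡∑ (upTo m))) (∑-upTo m (x ^_))
    where
    foldr≡∑ : ∀ ks → foldr (λ k s → x ^ k + s) 0# ks ≡ ∑ ks (x ^_)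
    foldr≡∑ [] = ≡.refl
    foldr≡∑ (k ∷ ks) = ≡.cong (λ s → x ^ k + s) (foldr≡∑ ks)

  []-cong : ∀ m {x y} → x ≈ y → [ m ] x ≈ [ m ] y
  []-cong m {x} {y} x≈y = begin
    [ m ] x            ≈⟨ []≈sumBelow m x ⟩
    sumBelow m (x ^_)  ≈⟨ sumBelow-cong m (λ i _ → ^-congˡ i x≈y) ⟩
    sumBelow m (y ^_)  ≈⟨ []≈sumBelow m y ⟨
    [ m ] y            ∎

  [2*m]≈[m+m] : ∀ m x → [ 2 ℕ.* m ] x ≈ [ m ℕ.+ m ] x
  [2*m]≈[m+m] m x = reflexive (≡.cong (λ n → [ m ℕ.+ n ] x) (ℕP.+-identityʳ m))

  []-suc : ∀ m x → [ suc m ] x ≈ [ m ] x + x ^ m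
  []-suc m x = trans ([]≈sumBelow (suc m) x) (+-congʳ (sym ([]≈sumBelow m x)))

  []-+ : ∀ m n x → [ m ℕ.+ n ] x ≈ [ m ] x + x ^ m * [ n ] x
  []-+ m n x = begin
    [ m ℕ.+ n ] x ≈⟨ []≈sumBelow (m ℕ.+ n) x ⟩
    sumBelow (m ℕ.+ n) (x ^_) ≈⟨ sumBelow-+ m n (x ^_) ⟩
    sumBelow m (x ^_) + sumBelow n (λ i → x ^ (m ℕ.+ i))
      ≈⟨ +-cong ([]≈sumBelow m x) (sumBelow-cong n (λ i _ → sym (^-homo-* x m i))) ⟨
    [ m ] x + sumBelow n (λ i → x ^ m * x ^ i) ≈⟨ +-congˡ (sumBelow-*ˡ n (x ^ m) (x ^_)) ⟩
    [ m ] x + x ^ m * sumBelow n (x ^_)        ≈⟨ +-congˡ (*-congˡ ([]≈sumBelow n x)) ⟨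
    [ m ] x + x ^ m * [ n ] x                  ∎

  []-double : ∀ m x → [ m ℕ.+ m ] x ≈ (1# + x) * [ m ] (x * x)
  []-double zero x = sym (zeroʳ _)
  []-double (suc m) x = begin
    [ suc m ℕ.+ suc m ] x ≡⟨ ≡.cong (λ k → [ suc k ] x) (ℕP.+-suc m m) ⟩
    [ suc (suc (m ℕ.+ m)) ] x ≈⟨ trans ([]-suc (suc (m ℕ.+ m)) x) (+-congʳ ([]-suc (m ℕ.+ m) x)) ⟩
    ([ m ℕ.+ m ] x + x ^ (m ℕ.+ m)) + x * x ^ (m ℕ.+ m) ≈⟨ +-cong (+-cong ([]-double m x) x^2m) (*-congˡ x^2m) ⟩
    ((1# + x) * [ m ] (x * x) + (x * x) ^ m) + x * (x * x) ^ m
      ≈⟨ solve 3 (λ x b p → ((con 1 :+ x) :* b :+ p) :+ x :* p := (con 1 :+ x) :* (b :+ p)) refl x ([ m ] (x * x)) ((x * x) ^ m) ⟩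
    (1# + x) * ([ m ] (x * x) + (x * x) ^ m) ≈⟨ *-congˡ ([]-suc m (x * x)) ⟨
    (1# + x) * [ suc m ] (x * x) ∎
    where
    x^2m : x ^ (m ℕ.+ m) ≈ (x * x) ^ m
    x^2m = trans (^-homo-* x m m) (sym (^-distrib-* x x m))

  []-double-negated : ∀ m {z} x → z ≈ - 1# → (1# + x) * [ m ℕ.+ m ] (z * x) ≈ (1# - x) * [ m ℕ.+ m ] x
  []-double-negated m {z} x z≈-1 = begin
    (1# + x) * [ m ℕ.+ m ] (z * x) ≈⟨ *-congˡ ([]-double m (z * x)) ⟩
    (1# + x) * ((1# + z * x) * [ m ] ((z * x) * (z * x))) ≈⟨ *-congˡ (*-cong (+-congˡ zx≈-x) ([]-cong m square)) ⟩
    (1# + x) * ((1# - x) * [ m ] (x * x))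
      ≈⟨ solve 3 (λ x y b → (con 1 :+ x) :* (y :* b) := y :* ((con 1 :+ x) :* b)) refl x (1# - x) ([ m ] (x * x)) ⟩
    (1# - x) * ((1# + x) * [ m ] (x * x)) ≈⟨ *-congˡ ([]-double m x) ⟨
    (1# - x) * [ m ℕ.+ m ] x ∎
    where
    zx≈-x : z * x ≈ - x
    zx≈-x = trans (*-congʳ z≈-1) (-1*x≈-x x)
    square : (z * x) * (z * x) ≈ x * x
    square = trans (solve 2 (λ z x → (z :* x) :* (z :* x) := (z :* z) :* (x :* x)) refl z x)
      (trans (*-congʳ (trans (*-cong z≈-1 z≈-1) (trans (-1*x≈-x (- 1#)) (-‿involutive 1#)))) (*-identityˡ _))

  -- x^d [2K]_x is [2K]_x with its first d terms moved to the top, i.e. multiplied by x^{2K}.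
  []-rotate : ∀ d e K x Q → d ℕ.+ e ≡ K → Q ≈ x ^ (K ℕ.+ K) →
    x ^ K * [ K ] x + sumBelow K (λ t → (if ⌊ t ℕ.<? d ⌋ then Q else 1#) * x ^ t) ≈ x ^ d * [ K ℕ.+ K ] x
  []-rotate d e .(d ℕ.+ e) x Q ≡.refl Q≈x^2K = begin
    x ^ K * [ K ] x + sumBelow K C
      ≈⟨ +-congˡ (sumBelow-+ d e C) ⟩
    x ^ K * [ K ] x + (sumBelow d C + sumBelow e (λ t → C (d ℕ.+ t)))
      ≈⟨ +-congˡ (+-cong (trans (sumBelow-cong d lower) (sumBelow-*ˡ d Q (x ^_)))
                         (trans (sumBelow-cong e upper) (sumBelow-*ˡ e (x ^ d) (x ^_)))) ⟩
    x ^ K * [ K ] x + (Q * sumBelow d (x ^_) + x ^ d * sumBelow e (x ^_))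
      ≈⟨ +-congˡ (+-cong (*-cong (trans Q≈x^2K (^-homo-* x K K)) (sym ([]≈sumBelow d x))) (*-congˡ (sym ([]≈sumBelow e x)))) ⟩
    x ^ K * [ K ] x + ((x ^ K * x ^ K) * [ d ] x + x ^ d * [ e ] x)
      ≈⟨ solve 5 (λ xK GK Gd xd Ge → xK :* GK :+ ((xK :* xK) :* Gd :+ xd :* Ge) := xd :* Ge :+ xK :* (GK :+ xK :* Gd))
               refl (x ^ K) ([ K ] x) ([ d ] x) (x ^ d) ([ e ] x) ⟩
    x ^ d * [ e ] x + x ^ K * ([ K ] x + x ^ K * [ d ] x)
      ≈⟨ +-congˡ (*-cong (^-homo-* x d e) (sym ([]-+ K d x))) ⟩
    x ^ d * [ e ] x + (x ^ d * x ^ e) * [ K ℕ.+ d ] x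
      ≈⟨ solve 4 (λ xd Ge xe G → xd :* Ge :+ (xd :* xe) :* G := xd :* (Ge :+ xe :* G)) refl (x ^ d) ([ e ] x) (x ^ e) ([ K ℕ.+ d ] x) ⟩
    x ^ d * ([ e ] x + x ^ e * [ K ℕ.+ d ] x) ≈⟨ *-congˡ ([]-+ e (K ℕ.+ d) x) ⟨
    x ^ d * [ e ℕ.+ (K ℕ.+ d) ] x ≡⟨ ≡.cong (λ n → x ^ d * [ n ] x) (twice-K d e) ⟩
    x ^ d * [ K ℕ.+ K ] x ∎
    where
    K = d ℕ.+ e
    C : ℕ → Carrier
    C t = (if ⌊ t ℕ.<? d ⌋ then Q else 1#) * x ^ t
    lower : ∀ t → t < d → C t ≈ Q * x ^ t
    lower t t<d = reflexive (≡.cong (λ b → (if b then Q else 1#) * x ^ t) (isYes-true (t ℕ.<? d) t<d))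
    upper : ∀ t → t < e → C (d ℕ.+ t) ≈ x ^ d * x ^ t
    upper t _ = trans (reflexive (≡.cong (λ b → (if b then Q else 1#) * x ^ (d ℕ.+ t))
                                         (isYes-false (d ℕ.+ t ℕ.<? d) (ℕP.m+n≮m d t))))
                      (trans (*-identityˡ _) (^-homo-* x d t))
    twice-K : ∀ d e → e ℕ.+ ((d ℕ.+ e) ℕ.+ d) ≡ (d ℕ.+ e) ℕ.+ (d ℕ.+ e)
    twice-K = solve-∀

module Signs {c ℓ} (R : CommutativeRing c ℓ) where
  open CommutativeRing R
  open RingDefs R
  open import Algebra.Definitions.RawSemiring (Algebra.Bundles.Semiring.rawSemiring semiring) using (_^_)
  open import Algebra.Properties.Semiring.Exp semiring using (^-homo-*; ^-congˡ)
  open import Algebra.Properties.CommutativeSemiring.Exp commutativeSemiring using (^-distrib-*)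
  open import Algebra.Properties.Ring ring using (-1*x≈-x; -‿involutive)
  open import Relation.Binary.Reasoning.Setoid setoid

  1^n≈1 : ∀ n → 1# ^ n ≈ 1#
  1^n≈1 zero = refl
  1^n≈1 (suc n) = trans (*-identityˡ _) (1^n≈1 n)

  sgn-square : ∀ ε → sgn ε * sgn ε ≈ 1#
  sgn-square Sign.+ = *-identityˡ 1#
  sgn-square Sign.- = trans (-1*x≈-x (- 1#)) (-‿involutive 1#)

  sgn^even : ∀ ε t → sgn ε ^ (t ℕ.+ t) ≈ 1#
  sgn^even ε t = begin
    sgn ε ^ (t ℕ.+ t)         ≈⟨ ^-homo-* (sgn ε) t t ⟩
    sgn ε ^ t * sgn ε ^ t     ≈⟨ ^-distrib-* (sgn ε) (sgn ε) t ⟨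
    (sgn ε * sgn ε) ^ t       ≈⟨ ^-congˡ t (sgn-square ε) ⟩
    1# ^ t                    ≈⟨ 1^n≈1 t ⟩
    1#                        ∎

  sgn^-+even : ∀ ε a t → sgn ε ^ (a ℕ.+ (t ℕ.+ t)) ≈ sgn ε ^ a
  sgn^-+even ε a t = trans (^-homo-* (sgn ε) a (t ℕ.+ t)) (trans (*-congˡ (sgn^even ε t)) (*-identityʳ _))

module LastLetterSums {c ℓ} (R : CommutativeRing c ℓ) (ε : Sign) (q : CommutativeRing.Carrier R) where
  open CommutativeRing R
  open RingDefs R
  open RingSums R
  open QIntegers R
  open Signs R
  open import Algebra.Definitions.RawSemiring (Algebra.Bundles.Semiring.rawSemiring semiring) using (_^_)
  open import Algebra.Properties.Semiring.Exp semiring using (^-homo-*; ^-assocʳ; ^-congˡ)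
  open import Algebra.Properties.CommutativeSemiring.Exp commutativeSemiring using (^-distrib-*)
  open import Algebra.Solver.Ring.NaturalCoefficients.Default commutativeSemiring using (solve; _:*_; _:=_; con)
  open import Relation.Binary.Reasoning.Setoid setoid

  s : Carrier
  s = sgn ε

  weight : List ℤ → Carrier
  weight γ = (s ^ ℓB γ) * (q ^ fmaj γ)

  ε^_·q : ℕ → Carrier
  ε^ k ·q = (s ^ k) * q

  ∏brackets : ℕ → Carrier
  ∏brackets k = prodBelow k (λ i → [ 2 ℕ.* suc i ] (ε^ suc i ·q))

  sumEndingIn : ℕ → ℤ → Carrier
  sumEndingIn k a = ∑ (Bn k) (weight ∘ insertLast a)

  -- insertLast a adds 2K to fmaj, for a word of length K ending in b, exactly when a ≺ the lifted b.
  descentFactor : ℕ → ℤ → ℤ → Carrier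
  descentFactor K a b = if a ≺ liftLetter (letterIndex a) b then q ^ (2 ℕ.* K) else 1#

  ∑-Bn-suc : ∀ k f → ∑ (Bn (suc k)) f ≈ ∑ (signedRange (suc k)) (λ a → ∑ (Bn k) (f ∘ insertLast a))
  ∑-Bn-suc k f = trans (∑-↭ f (Bn-suc↭ k)) (∑-cartesianProductWith insertLast (signedRange (suc k)) (Bn k) f)

  q^2descentAt : ∀ a b K → q ^ (2 ℕ.* descentAt a b K) ≈ (if a ≺ b then q ^ (2 ℕ.* K) else 1#)
  q^2descentAt a b K with a ≺ b
  ... | true = refl
  ... | false = refl

  weight-insertLast : ∀ a b δ c → ℓB (insertLast a (insertLast b δ)) ≡ ℓB (insertLast b δ) ℕ.+ c →
    weight (insertLast a (insertLast b δ)) ≈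
      (s ^ c * q ^ negCount (a ∷ [])) * (descentFactor (suc (length δ)) a b * weight (insertLast b δ))
  weight-insertLast a b δ c ℓB≡ = begin
    s ^ ℓB (insertLast a γ) * q ^ fmaj (insertLast a γ)
      ≡⟨ ≡.cong₂ (λ m n → s ^ m * q ^ n) ℓB≡ (fmaj-insertLast a (map (liftLetter (letterIndex b)) δ) b) ⟩
    s ^ (ℓB γ ℕ.+ c) * q ^ (fmaj γ ℕ.+ 2 ℕ.* D ℕ.+ N)
      ≈⟨ *-cong (^-homo-* s (ℓB γ) c) (trans (^-homo-* q (fmaj γ ℕ.+ 2 ℕ.* D) N) (*-congʳ (^-homo-* q (fmaj γ) (2 ℕ.* D)))) ⟩
    (s ^ ℓB γ * s ^ c) * ((q ^ fmaj γ * q ^ (2 ℕ.* D)) * q ^ N)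
      ≈⟨ solve 5 (λ a b c d e → (a :* b) :* ((c :* d) :* e) := (b :* e) :* (d :* (a :* c)))
               refl (s ^ ℓB γ) (s ^ c) (q ^ fmaj γ) (q ^ (2 ℕ.* D)) (q ^ N) ⟩
    (s ^ c * q ^ N) * (q ^ (2 ℕ.* D) * weight γ)
      ≈⟨ *-congˡ (*-congʳ (trans (q^2descentAt a _ _)
           (reflexive (≡.cong (λ n → if a ≺ _ then q ^ (2 ℕ.* suc n) else 1#) (LP.length-map _ δ))))) ⟩
    (s ^ c * q ^ N) * (descentFactor (suc (length δ)) a b * weight γ) ∎
    where
    γ = insertLast b δ
    N = negCount (a ∷ [])
    D = descentAt a (liftLetter (letterIndex a) b) (suc (length (map (liftLetter (letterIndex b)) δ)))

  sumEndingIn-suc : ∀ k a c → (∀ {γ} → IsSignedPerm (suc k) γ → ℓB (insertLast a γ) ≡ ℓB γ ℕ.+ c) →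
    sumEndingIn (suc k) a ≈ (s ^ c * q ^ negCount (a ∷ [])) *
      (sumBelow (suc k) (λ i → descentFactor (suc k) a -[1+ i ] * sumEndingIn k -[1+ i ]) +
       sumBelow (suc k) (λ i → descentFactor (suc k) a (+ suc i) * sumEndingIn k (+ suc i)))
  sumEndingIn-suc k a c ℓB≡ = begin
    ∑ (Bn (suc k)) (weight ∘ insertLast a)
      ≈⟨ ∑-Bn-suc k (weight ∘ insertLast a) ⟩
    ∑ (signedRange (suc k)) (λ b → ∑ (Bn k) (λ δ → weight (insertLast a (insertLast b δ))))
      ≈⟨ ∑-cong (signedRange (suc k)) (λ b∈ → ∑-cong (Bn k) (λ δ∈ → inserted b∈ δ∈)) ⟩
    ∑ (signedRange (suc k)) (λ b → ∑ (Bn k) (λ δ → A * (descentFactor (suc k) a b * weight (insertLast b δ))))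
      ≈⟨ ∑-cong (signedRange (suc k)) (λ _ → trans (∑-*ˡ (Bn k) A _) (*-congˡ (∑-*ˡ (Bn k) _ _))) ⟩
    ∑ (signedRange (suc k)) (λ b → A * (descentFactor (suc k) a b * sumEndingIn k b))
      ≈⟨ ∑-*ˡ (signedRange (suc k)) A _ ⟩
    A * ∑ (signedRange (suc k)) (λ b → descentFactor (suc k) a b * sumEndingIn k b)
      ≈⟨ *-congˡ (∑-signedRange (suc k) _) ⟩
    A * (sumBelow (suc k) (λ i → descentFactor (suc k) a -[1+ i ] * sumEndingIn k -[1+ i ]) +
         sumBelow (suc k) (λ i → descentFactor (suc k) a (+ suc i) * sumEndingIn k (+ suc i))) ∎
    where
    A = s ^ c * q ^ negCount (a ∷ [])
    inserted : ∀ {b δ} → b ∈ signedRange (suc k) → δ ∈ Bn k →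
      weight (insertLast a (insertLast b δ)) ≈ A * (descentFactor (suc k) a b * weight (insertLast b δ))
    inserted {b} {δ} b∈ δ∈ with δ-perm ← ∈-Bn⁻ k δ∈ =
      trans (weight-insertLast a b δ c (ℓB≡ (isSignedPerm-insertLast k (∈-signedRange⁻ b∈) δ-perm)))
            (reflexive (≡.cong (λ n → A * (descentFactor (suc n) a b * weight (insertLast b δ))) (proj₁ δ-perm)))

  ε^·q-^ : ∀ m n → ε^ m ·q ^ n ≈ s ^ (m ℕ.* n) * q ^ n
  ε^·q-^ m n = trans (^-distrib-* (s ^ m) q n) (*-congʳ (^-assocʳ s m n))

  q^2K≈ : ∀ K → q ^ (2 ℕ.* K) ≈ ε^ K ·q ^ (K ℕ.+ K)
  q^2K≈ K = begin
    q ^ (2 ℕ.* K)                           ≡⟨ ≡.cong (λ n → q ^ (K ℕ.+ n)) (ℕP.+-identityʳ K) ⟩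
    q ^ (K ℕ.+ K)                           ≈⟨ *-identityˡ _ ⟨
    1# * q ^ (K ℕ.+ K)                      ≈⟨ *-congʳ (sgn^even ε (K ℕ.* K)) ⟨
    s ^ (K ℕ.* K ℕ.+ K ℕ.* K) * q ^ (K ℕ.+ K) ≡⟨ ≡.cong (λ n → s ^ n * q ^ (K ℕ.+ K)) (ℕP.*-distribˡ-+ K K K) ⟨
    s ^ (K ℕ.* (K ℕ.+ K)) * q ^ (K ℕ.+ K)   ≈⟨ ε^·q-^ K (K ℕ.+ K) ⟨
    ε^ K ·q ^ (K ℕ.+ K)                     ∎

  ε^suc·q-^ : ∀ K d → s ^ d * ε^ K ·q ^ d ≈ ε^ suc K ·q ^ d
  ε^suc·q-^ K d = sym (trans (^-congˡ d (*-assoc s (s ^ K) q)) (^-distrib-* s (ε^ K ·q) d))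

  -- The sign exponents differ by 2d: (K+1)(K+d+1) = (K+j+1) + K(K+d) + 2d when j + d = K.
  ε^suc·q-^suc : ∀ K j d → j ℕ.+ d ≡ K →
    (s ^ (K ℕ.+ suc j) * q) * ε^ K ·q ^ (K ℕ.+ d) ≈ ε^ suc K ·q ^ suc (K ℕ.+ d)
  ε^suc·q-^suc .(j ℕ.+ d) j d ≡.refl = begin
    (s ^ E₁ * q) * ε^ K ·q ^ (K ℕ.+ d)               ≈⟨ *-congˡ (ε^·q-^ K (K ℕ.+ d)) ⟩
    (s ^ E₁ * q) * (s ^ E₂ * q ^ (K ℕ.+ d))          ≈⟨ solve 4 (λ a b c e → (a :* b) :* (c :* e) := (a :* c) :* (b :* e))
                                                              refl (s ^ E₁) q (s ^ E₂) (q ^ (K ℕ.+ d)) ⟩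
    (s ^ E₁ * s ^ E₂) * q ^ suc (K ℕ.+ d)            ≈⟨ *-congʳ (^-homo-* s E₁ E₂) ⟨
    s ^ (E₁ ℕ.+ E₂) * q ^ suc (K ℕ.+ d)              ≈⟨ *-congʳ (sgn^-+even ε (E₁ ℕ.+ E₂) d) ⟨
    s ^ (E₁ ℕ.+ E₂ ℕ.+ (d ℕ.+ d)) * q ^ suc (K ℕ.+ d) ≡⟨ ≡.cong (λ n → s ^ n * q ^ suc (K ℕ.+ d)) (exponents j d) ⟨
    s ^ (suc K ℕ.* suc (K ℕ.+ d)) * q ^ suc (K ℕ.+ d) ≈⟨ ε^·q-^ (suc K) (suc (K ℕ.+ d)) ⟨
    ε^ suc K ·q ^ suc (K ℕ.+ d)                       ∎
    where
    K = j ℕ.+ d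
    E₁ = K ℕ.+ suc j
    E₂ = K ℕ.* (K ℕ.+ d)
    exponents : ∀ j d → suc (j ℕ.+ d) ℕ.* suc ((j ℕ.+ d) ℕ.+ d) ≡
                        ((j ℕ.+ d) ℕ.+ suc j) ℕ.+ (j ℕ.+ d) ℕ.* ((j ℕ.+ d) ℕ.+ d) ℕ.+ (d ℕ.+ d)
    exponents = solve-∀

  ClosedForm : ℕ → Set ℓ
  ClosedForm k = ∀ j d → j ℕ.+ d ≡ k →
    sumEndingIn k (+ suc j) ≈ ε^ suc k ·q ^ d * ∏brackets k × sumEndingIn k -[1+ j ] ≈ ε^ suc k ·q ^ suc (k ℕ.+ d) * ∏brackets k

  descentFactor-pos : ∀ {k j d i} → j ℕ.+ d ≡ suc k → i ≤ k →
    descentFactor (suc k) (+ suc j) (+ suc i) ≡ (if ⌊ k ℕ.∸ i ℕ.<? d ⌋ then q ^ (2 ℕ.* suc k) else 1#)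
  descentFactor-pos {k} {j} {d} {i} j+d≡ i≤k = ≡.cong (λ b → if b then q ^ (2 ℕ.* suc k) else 1#)
    (≡.trans (≺-liftLetter-pos j i) (isYes-⇔ (j ℕ.≤? i) (k ℕ.∸ i ℕ.<? d) (≤⇔∸< j+d≡ i≤k)))

  descentFactor-neg : ∀ {k j d i} → j ℕ.+ d ≡ suc k → i ≤ k →
    descentFactor (suc k) -[1+ j ] -[1+ i ] ≡ (if ⌊ k ℕ.∸ i ℕ.<? d ⌋ then q ^ (2 ℕ.* suc k) else 1#)
  descentFactor-neg {k} {j} {d} {i} j+d≡ i≤k = ≡.cong (λ b → if b then q ^ (2 ℕ.* suc k) else 1#)
    (≡.trans (≺-liftLetter-neg j i) (isYes-⇔ (j ℕ.≤? i) (k ℕ.∸ i ℕ.<? d) (≤⇔∸< j+d≡ i≤k)))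

  module _ (k : ℕ) (IH : ClosedForm k) (j d : ℕ) (j+d≡ : j ℕ.+ d ≡ suc k) where
    private
      K = suc k
      x = ε^ K ·q
      Q = q ^ (2 ℕ.* K)
      C : ℕ → Carrier
      C t = if ⌊ t ℕ.<? d ⌋ then Q else 1#
      A = sumBelow K (λ t → C t * x ^ t)
      IH′ : ∀ i → i < K → sumEndingIn k (+ suc i) ≈ x ^ (k ℕ.∸ i) * ∏brackets k × sumEndingIn k -[1+ i ] ≈ x ^ suc (k ℕ.+ (k ℕ.∸ i)) * ∏brackets k
      IH′ i i<K = IH i (k ℕ.∸ i) (ℕP.m+[n∸m]≡n (ℕP.≤-pred i<K))
      rotated : x ^ K * [ K ] x + A ≈ x ^ d * [ K ℕ.+ K ] x
      rotated = []-rotate d j K x Q (≡.trans (ℕP.+-comm d j) j+d≡) (q^2K≈ K)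

    sumEndingIn-pos : sumEndingIn K (+ suc j) ≈ ε^ suc K ·q ^ d * ∏brackets K
    sumEndingIn-pos = begin
      sumEndingIn K (+ suc j)
        ≈⟨ sumEndingIn-suc k (+ suc j) d (λ perm → ℓB-insertLast-pos K perm j d j+d≡) ⟩
      (s ^ d * 1#) * (sumBelow K (λ i → 1# * sumEndingIn k -[1+ i ]) + sumBelow K (λ i → descentFactor K (+ suc j) (+ suc i) * sumEndingIn k (+ suc i)))
        ≈⟨ *-congˡ (+-cong (sumBelow-cong K (λ i i<K → *-congˡ (proj₂ (IH′ i i<K))))
                           (sumBelow-cong K (λ i i<K → *-cong (reflexive (descentFactor-pos j+d≡ (ℕP.≤-pred i<K))) (proj₁ (IH′ i i<K))))) ⟩
      (s ^ d * 1#) * (sumBelow K (λ i → f₁ (k ℕ.∸ i)) + sumBelow K (λ i → f₂ (k ℕ.∸ i)))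
        ≈⟨ *-congˡ (+-cong (sumBelow-reverse K f₁) (sumBelow-reverse K f₂)) ⟩
      (s ^ d * 1#) * (sumBelow K f₁ + sumBelow K f₂)
        ≈⟨ *-congˡ (trans (+-cong Σf₁ Σf₂) (sym (distribˡ (∏brackets k) _ _))) ⟩
      (s ^ d * 1#) * (∏brackets k * (x ^ K * [ K ] x + A))
        ≈⟨ *-congˡ (*-congˡ rotated) ⟩
      (s ^ d * 1#) * (∏brackets k * (x ^ d * [ K ℕ.+ K ] x))
        ≈⟨ solve 4 (λ a p b g → (a :* con 1) :* (p :* (b :* g)) := (a :* b) :* (p :* g)) refl (s ^ d) (∏brackets k) (x ^ d) ([ K ℕ.+ K ] x) ⟩
      (s ^ d * x ^ d) * (∏brackets k * [ K ℕ.+ K ] x)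
        ≈⟨ *-cong (ε^suc·q-^ K d) (*-congˡ (sym ([2*m]≈[m+m] K x))) ⟩
      ε^ suc K ·q ^ d * ∏brackets K ∎
      where
      f₁ f₂ : ℕ → Carrier
      f₁ t = 1# * (x ^ suc (k ℕ.+ t) * ∏brackets k)
      f₂ t = C t * (x ^ t * ∏brackets k)
      Σf₁ : sumBelow K f₁ ≈ ∏brackets k * (x ^ K * [ K ] x)
      Σf₁ = begin
        sumBelow K f₁ ≈⟨ sumBelow-cong K (λ t _ → trans (*-identityˡ _) (trans (*-comm _ _) (*-congˡ (^-homo-* x K t)))) ⟩
        sumBelow K (λ t → ∏brackets k * (x ^ K * x ^ t)) ≈⟨ trans (sumBelow-*ˡ K (∏brackets k) _) (*-congˡ (sumBelow-*ˡ K (x ^ K) (x ^_))) ⟩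
        ∏brackets k * (x ^ K * sumBelow K (x ^_))        ≈⟨ *-congˡ (*-congˡ ([]≈sumBelow K x)) ⟨
        ∏brackets k * (x ^ K * [ K ] x)                  ∎
      Σf₂ : sumBelow K f₂ ≈ ∏brackets k * A
      Σf₂ = trans (sumBelow-cong K (λ t _ → solve 3 (λ c a p → c :* (a :* p) := p :* (c :* a)) refl (C t) (x ^ t) (∏brackets k)))
                  (sumBelow-*ˡ K (∏brackets k) _)

    sumEndingIn-neg : sumEndingIn K -[1+ j ] ≈ ε^ suc K ·q ^ suc (K ℕ.+ d) * ∏brackets K
    sumEndingIn-neg = begin
      sumEndingIn K -[1+ j ]
        ≈⟨ sumEndingIn-suc k -[1+ j ] (K ℕ.+ suc j) (λ perm → ℓB-insertLast-neg K perm j) ⟩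
      a * (sumBelow K (λ i → descentFactor K -[1+ j ] -[1+ i ] * sumEndingIn k -[1+ i ]) + sumBelow K (λ i → Q * sumEndingIn k (+ suc i)))
        ≈⟨ *-congˡ (+-cong (sumBelow-cong K (λ i i<K → *-cong (reflexive (descentFactor-neg j+d≡ (ℕP.≤-pred i<K))) (proj₂ (IH′ i i<K))))
                           (sumBelow-cong K (λ i i<K → *-congˡ (proj₁ (IH′ i i<K))))) ⟩
      a * (sumBelow K (λ i → f₁ (k ℕ.∸ i)) + sumBelow K (λ i → f₂ (k ℕ.∸ i)))
        ≈⟨ *-congˡ (+-cong (sumBelow-reverse K f₁) (sumBelow-reverse K f₂)) ⟩
      a * (sumBelow K f₁ + sumBelow K f₂)
        ≈⟨ *-congˡ (trans (+-cong Σf₁ Σf₂) (trans (sym (distribˡ (∏brackets k * x ^ K) _ _)) (*-congˡ (+-comm _ _)))) ⟩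
      a * ((∏brackets k * x ^ K) * (x ^ K * [ K ] x + A))
        ≈⟨ *-congˡ (*-congˡ rotated) ⟩
      a * ((∏brackets k * x ^ K) * (x ^ d * [ K ℕ.+ K ] x))
        ≈⟨ solve 6 (λ e q p y z g → (e :* (q :* con 1)) :* ((p :* y) :* (z :* g)) := ((e :* q) :* (y :* z)) :* (p :* g))
                 refl (s ^ (K ℕ.+ suc j)) q (∏brackets k) (x ^ K) (x ^ d) ([ K ℕ.+ K ] x) ⟩
      ((s ^ (K ℕ.+ suc j) * q) * (x ^ K * x ^ d)) * (∏brackets k * [ K ℕ.+ K ] x)
        ≈⟨ *-cong (trans (*-congˡ (sym (^-homo-* x K d))) (ε^suc·q-^suc K j d j+d≡))
                  (*-congˡ (sym ([2*m]≈[m+m] K x))) ⟩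
      ε^ suc K ·q ^ suc (K ℕ.+ d) * ∏brackets K ∎
      where
      a = s ^ (K ℕ.+ suc j) * q ^ 1
      f₁ f₂ : ℕ → Carrier
      f₁ t = C t * (x ^ suc (k ℕ.+ t) * ∏brackets k)
      f₂ t = Q * (x ^ t * ∏brackets k)
      Σf₁ : sumBelow K f₁ ≈ (∏brackets k * x ^ K) * A
      Σf₁ = trans (sumBelow-cong K (λ t _ → trans (*-congˡ (*-congʳ (^-homo-* x K t)))
                    (solve 4 (λ c y z p → c :* ((y :* z) :* p) := (p :* y) :* (c :* z)) refl (C t) (x ^ K) (x ^ t) (∏brackets k))))
                  (sumBelow-*ˡ K (∏brackets k * x ^ K) _)
      Σf₂ : sumBelow K f₂ ≈ (∏brackets k * x ^ K) * (x ^ K * [ K ] x)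
      Σf₂ = begin
        sumBelow K f₂ ≈⟨ sumBelow-cong K (λ t _ → solve 3 (λ a b p → a :* (b :* p) := (a :* p) :* b) refl Q (x ^ t) (∏brackets k)) ⟩
        sumBelow K (λ t → (Q * ∏brackets k) * x ^ t) ≈⟨ sumBelow-*ˡ K (Q * ∏brackets k) (x ^_) ⟩
        (Q * ∏brackets k) * sumBelow K (x ^_) ≈⟨ *-cong (*-congʳ (sym (trans (q^2K≈ K) (^-homo-* x K K)))) ([]≈sumBelow K x) ⟨
        ((x ^ K * x ^ K) * ∏brackets k) * [ K ] x
          ≈⟨ solve 3 (λ y p g → ((y :* y) :* p) :* g := (p :* y) :* (y :* g)) refl (x ^ K) (∏brackets k) ([ K ] x) ⟩
        (∏brackets k * x ^ K) * (x ^ K * [ K ] x) ∎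

  sumEndingIn-closed : ∀ k → ClosedForm k
  sumEndingIn-closed zero zero zero ≡.refl = +-identityʳ _ , trans (+-identityʳ _)
    (solve 2 (λ s q → (s :* con 1) :* (q :* con 1) := (((s :* con 1) :* q) :* con 1) :* con 1) refl s q)
  sumEndingIn-closed zero zero (suc d) ()
  sumEndingIn-closed zero (suc j) d ()
  sumEndingIn-closed (suc k) j d j+d≡ = sumEndingIn-pos k (sumEndingIn-closed k) j d j+d≡ , sumEndingIn-neg k (sumEndingIn-closed k) j d j+d≡

  lhs≈∑sumEndingIn : ∀ k → lhs ε (suc k) q ≈ sumBelow k (λ i → sumEndingIn k (+ suc i))
  lhs≈∑sumEndingIn k = begin
    ∑ (filter (λ γ → lastCond n γ Bool.≟ true) (Bn n)) weight
      ≈⟨ ∑-filter (λ γ → lastCond n γ Bool.≟ true) (Bn n) weight ⟩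
    ∑ (Bn n) (λ γ → if ⌊ lastCond n γ Bool.≟ true ⌋ then weight γ else 0#)
      ≈⟨ ∑-cong (Bn n) (λ {γ} _ → reflexive (≡.cong (λ b → if b then weight γ else 0#) (≟true (lastCond n γ)))) ⟩
    ∑ (Bn n) (λ γ → if lastCond n γ then weight γ else 0#)
      ≈⟨ ∑-Bn-suc k _ ⟩
    ∑ (signedRange n) (λ a → ∑ (Bn k) (λ δ → if lastCond n (insertLast a δ) then weight (insertLast a δ) else 0#))
      ≈⟨ ∑-cong (signedRange n) (λ {a} _ → trans (∑-cong (Bn k) (λ {δ} _ →
           reflexive (≡.cong (λ b → if b then weight (insertLast a δ) else 0#) (lastCond-∷ʳ n (map (liftLetter (letterIndex a)) δ) a))))
           (∑-if (lastLetterCond n a) (Bn k) (weight ∘ insertLast a))) ⟩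
    ∑ (signedRange n) (λ a → if lastLetterCond n a then sumEndingIn k a else 0#)
      ≈⟨ ∑-signedRange n _ ⟩
    sumBelow n (λ _ → 0#) + (sumBelow k last<n + last<n k)
      ≈⟨ +-cong (sumBelow-0# n) (+-cong (sumBelow-cong k (λ i i<k → reflexive (≡.cong (λ b → if b then sumEndingIn k (+ suc i) else 0#)
                                                                 (isYes-true (suc i ℕ.<? n) (s≤s i<k)))))
                                        (reflexive (≡.cong (λ b → if b then sumEndingIn k (+ suc k) else 0#)
                                                                 (isYes-false (suc k ℕ.<? n) (ℕP.<-irrefl ≡.refl))))) ⟩
    0# + (sumBelow k (λ i → sumEndingIn k (+ suc i)) + 0#) ≈⟨ trans (+-identityˡ _) (+-identityʳ _) ⟩
    sumBelow k (λ i → sumEndingIn k (+ suc i)) ∎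
    where
    n = suc k
    last<n : ℕ → Carrier
    last<n i = if lastLetterCond n (+ suc i) then sumEndingIn k (+ suc i) else 0#
    ≟true : ∀ b → ⌊ b Bool.≟ true ⌋ ≡ b
    ≟true true = ≡.refl
    ≟true false = ≡.refl

  ∑sumEndingIn≈rhs₁ : ∀ k → sumBelow k (λ i → sumEndingIn k (+ suc i)) ≈ rhs₁ ε (suc k) q
  ∑sumEndingIn≈rhs₁ k = begin
    sumBelow k (λ i → sumEndingIn k (+ suc i))
      ≈⟨ sumBelow-cong k (λ i i<k → trans (proj₁ (sumEndingIn-closed k i (k ℕ.∸ i) (ℕP.m+[n∸m]≡n (ℕP.<⇒≤ i<k))))
                                          (reflexive (≡.cong (λ e → x ^ e * ∏brackets k) (ℕP.+-∸-assoc 1 i<k)))) ⟩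
    sumBelow k (λ i → x ^ suc (k ℕ.∸ suc i) * ∏brackets k) ≈⟨ sumBelow-reverse k (λ t → x ^ suc t * ∏brackets k) ⟩
    sumBelow k (λ t → x ^ suc t * ∏brackets k)
      ≈⟨ sumBelow-cong k (λ t _ → solve 3 (λ x y p → (x :* y) :* p := (x :* p) :* y) refl x (x ^ t) (∏brackets k)) ⟩
    sumBelow k (λ t → (x * ∏brackets k) * x ^ t) ≈⟨ sumBelow-*ˡ k (x * ∏brackets k) (x ^_) ⟩
    (x * ∏brackets k) * sumBelow k (x ^_)        ≈⟨ *-cong (*-congˡ (prodR-upTo k _)) ([]≈sumBelow k x) ⟨
    rhs₁ ε (suc k) q                             ∎
    where
    x = ε^ suc k ·q

module SecondForm {c ℓ} (R : CommutativeRing c ℓ) (q : CommutativeRing.Carrier R) where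
  open CommutativeRing R
  open RingDefs R
  open RingSums R
  open QIntegers R
  open Signs R
  open import Algebra.Definitions.RawSemiring (Algebra.Bundles.Semiring.rawSemiring semiring) using (_^_)
  open import Algebra.Properties.Semiring.Exp semiring using (^-congˡ; ^-congʳ)
  open import Algebra.Properties.Ring ring using (-1*x≈-x; -‿involutive)
  open import Algebra.Solver.Ring.NaturalCoefficients.Default commutativeSemiring using (solve; _:*_; _:=_)
  open import Relation.Binary.Reasoning.Setoid setoid

  ∏brackets : Sign → ℕ → Carrier
  ∏brackets ε k = prodBelow k (λ i → [ 2 ℕ.* suc i ] ((sgn ε ^ suc i) * q))

  ∏brackets₁ : ℕ → Carrier
  ∏brackets₁ k = prodBelow k (λ i → [ 2 ℕ.* suc i ] q)

  []-at-even-power : ∀ ε L {e} t → e ≡ t ℕ.+ t → [ L ] ((sgn ε ^ e) * q) ≈ [ L ] q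
  []-at-even-power ε L t ≡.refl = []-cong L (trans (*-congʳ (sgn^even ε t)) (*-identityˡ q))

  []-at-odd-power : ∀ m L → [ L ℕ.+ L ] ((sgn Sign.- ^ suc (m ℕ.+ m)) * q) * (1# + q) ≈ [ L ℕ.+ L ] q * (1# - q)
  []-at-odd-power m L = trans (*-comm _ _) (trans ([]-double-negated L q sgn^odd) (*-comm _ _))
    where
    sgn^odd : sgn Sign.- ^ suc (m ℕ.+ m) ≈ - 1#
    sgn^odd = trans (*-congˡ (sgn^even Sign.- m)) (*-identityʳ (- 1#))

  mutual
    ∏brackets-even : ∀ m → (1# + q) ^ m * ∏brackets Sign.- (m ℕ.+ m) ≈ (1# - q) ^ m * ∏brackets₁ (m ℕ.+ m)
    ∏brackets-even zero = refl
    ∏brackets-even (suc m) = begin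
      (1# + q) ^ suc m * ∏brackets Sign.- (suc m ℕ.+ suc m) ≡⟨ ≡.cong (λ n → (1# + q) ^ suc m * ∏brackets Sign.- n) m+m+2 ⟩
      (1# + q) ^ suc m * (∏brackets Sign.- (suc (m ℕ.+ m)) * [ 2 ℕ.* e ] ((sgn Sign.- ^ e) * q))
        ≈⟨ *-congˡ (*-congˡ (trans ([2*m]≈[m+m] e _) (trans ([]-at-even-power Sign.- (e ℕ.+ e) (suc m) (≡.sym m+m+2))
                                      (sym ([2*m]≈[m+m] e q))))) ⟩
      (1# + q) ^ suc m * (∏brackets Sign.- (suc (m ℕ.+ m)) * [ 2 ℕ.* e ] q) ≈⟨ *-assoc _ _ _ ⟨
      ((1# + q) ^ suc m * ∏brackets Sign.- (suc (m ℕ.+ m))) * [ 2 ℕ.* e ] q ≈⟨ *-congʳ (∏brackets-odd m) ⟩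
      ((1# - q) ^ suc m * ∏brackets₁ (suc (m ℕ.+ m))) * [ 2 ℕ.* e ] q       ≈⟨ *-assoc _ _ _ ⟩
      (1# - q) ^ suc m * ∏brackets₁ (suc (suc (m ℕ.+ m)))                    ≡⟨ ≡.cong (λ n → (1# - q) ^ suc m * ∏brackets₁ n) m+m+2 ⟨
      (1# - q) ^ suc m * ∏brackets₁ (suc m ℕ.+ suc m)                        ∎
      where
      e = suc (suc (m ℕ.+ m))
      m+m+2 : suc m ℕ.+ suc m ≡ e
      m+m+2 = ≡.cong suc (ℕP.+-suc m m)

    ∏brackets-odd : ∀ m → (1# + q) ^ suc m * ∏brackets Sign.- (suc (m ℕ.+ m)) ≈ (1# - q) ^ suc m * ∏brackets₁ (suc (m ℕ.+ m))
    ∏brackets-odd m = begin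
      ((1# + q) * (1# + q) ^ m) * (∏brackets Sign.- (m ℕ.+ m) * [ 2 ℕ.* e ] ((sgn Sign.- ^ e) * q))
        ≈⟨ solve 4 (λ x y p b → (x :* y) :* (p :* b) := (y :* p) :* (b :* x)) refl (1# + q) ((1# + q) ^ m) (∏brackets Sign.- (m ℕ.+ m)) _ ⟩
      ((1# + q) ^ m * ∏brackets Sign.- (m ℕ.+ m)) * ([ 2 ℕ.* e ] ((sgn Sign.- ^ e) * q) * (1# + q))
        ≈⟨ *-cong (∏brackets-even m) (trans (*-congʳ ([2*m]≈[m+m] e _)) (trans ([]-at-odd-power m e) (*-congʳ (sym ([2*m]≈[m+m] e q))))) ⟩
      ((1# - q) ^ m * ∏brackets₁ (m ℕ.+ m)) * ([ 2 ℕ.* e ] q * (1# - q))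
        ≈⟨ solve 4 (λ x y p b → (y :* p) :* (b :* x) := (x :* y) :* (p :* b)) refl (1# - q) ((1# - q) ^ m) (∏brackets₁ (m ℕ.+ m)) _ ⟩
      ((1# - q) * (1# - q) ^ m) * (∏brackets₁ (m ℕ.+ m) * [ 2 ℕ.* e ] q) ∎
      where
      e = suc (m ℕ.+ m)

  1-sgn⁻q≈1+q : 1# - sgn Sign.- * q ≈ 1# + q
  1-sgn⁻q≈1+q = +-congˡ (trans (-‿cong (-1*x≈-x q)) (-‿involutive q))

  twisted≈untwisted : ∀ ε k → (1# - sgn ε * q) ^ ℕ.⌈ suc k /2⌉ * (∏brackets ε k * [ k ] ((sgn ε ^ suc k) * q))
                            ≈ (1# - q) ^ ℕ.⌈ suc k /2⌉ * (∏brackets₁ k * [ k ] q)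
  twisted≈untwisted Sign.+ k =
    *-cong (^-congˡ ℕ.⌈ suc k /2⌉ (+-congˡ (-‿cong (*-identityˡ q))))
           (*-cong (prodBelow-cong k (λ i _ → []-cong (2 ℕ.* suc i) (1^t*q≈q (suc i)))) ([]-cong k (1^t*q≈q (suc k))))
    where
    1^t*q≈q : ∀ t → (1# ^ t) * q ≈ q
    1^t*q≈q t = trans (*-congʳ (1^n≈1 t)) (*-identityˡ q)
  twisted≈untwisted Sign.- k with parity k
  ... | even m = begin
    (1# - sgn Sign.- * q) ^ suc ℕ.⌊ m ℕ.+ m /2⌋ * (∏brackets Sign.- (m ℕ.+ m) * B)
      ≈⟨ *-congʳ (trans (^-congˡ (suc ℕ.⌊ m ℕ.+ m /2⌋) 1-sgn⁻q≈1+q) (^-congʳ (1# + q) (≡.cong suc (≡.sym (ℕP.n≡⌊n+n/2⌋ m))))) ⟩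
    ((1# + q) * (1# + q) ^ m) * (∏brackets Sign.- (m ℕ.+ m) * B)
      ≈⟨ solve 4 (λ x y p b → (x :* y) :* (p :* b) := (y :* p) :* (b :* x)) refl (1# + q) ((1# + q) ^ m) (∏brackets Sign.- (m ℕ.+ m)) B ⟩
    ((1# + q) ^ m * ∏brackets Sign.- (m ℕ.+ m)) * (B * (1# + q))
      ≈⟨ *-cong (∏brackets-even m) ([]-at-odd-power m m) ⟩
    ((1# - q) ^ m * ∏brackets₁ (m ℕ.+ m)) * ([ m ℕ.+ m ] q * (1# - q))
      ≈⟨ solve 4 (λ x y p b → (y :* p) :* (b :* x) := (x :* y) :* (p :* b)) refl (1# - q) ((1# - q) ^ m) (∏brackets₁ (m ℕ.+ m)) ([ m ℕ.+ m ] q) ⟩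
    (1# - q) ^ suc m * (∏brackets₁ (m ℕ.+ m) * [ m ℕ.+ m ] q)
      ≡⟨ ≡.cong (λ n → (1# - q) ^ suc n * (∏brackets₁ (m ℕ.+ m) * [ m ℕ.+ m ] q)) (ℕP.n≡⌊n+n/2⌋ m) ⟩
    (1# - q) ^ suc ℕ.⌊ m ℕ.+ m /2⌋ * (∏brackets₁ (m ℕ.+ m) * [ m ℕ.+ m ] q) ∎
    where
    B = [ m ℕ.+ m ] ((sgn Sign.- ^ suc (m ℕ.+ m)) * q)
  ... | odd m = begin
    (1# - sgn Sign.- * q) ^ suc ℕ.⌈ m ℕ.+ m /2⌉ * (∏brackets Sign.- (suc (m ℕ.+ m)) * B)
      ≈⟨ *-cong (trans (^-congˡ (suc ℕ.⌈ m ℕ.+ m /2⌉) 1-sgn⁻q≈1+q) (^-congʳ (1# + q) (≡.cong suc (≡.sym (ℕP.n≡⌈n+n/2⌉ m)))))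
                (*-congˡ ([]-at-even-power Sign.- (suc (m ℕ.+ m)) (suc m) (≡.cong suc (≡.sym (ℕP.+-suc m m))))) ⟩
    (1# + q) ^ suc m * (∏brackets Sign.- (suc (m ℕ.+ m)) * [ suc (m ℕ.+ m) ] q) ≈⟨ *-assoc _ _ _ ⟨
    ((1# + q) ^ suc m * ∏brackets Sign.- (suc (m ℕ.+ m))) * [ suc (m ℕ.+ m) ] q ≈⟨ *-congʳ (∏brackets-odd m) ⟩
    ((1# - q) ^ suc m * ∏brackets₁ (suc (m ℕ.+ m))) * [ suc (m ℕ.+ m) ] q ≈⟨ *-assoc _ _ _ ⟩
    (1# - q) ^ suc m * (∏brackets₁ (suc (m ℕ.+ m)) * [ suc (m ℕ.+ m) ] q)
      ≡⟨ ≡.cong (λ n → (1# - q) ^ suc n * (∏brackets₁ (suc (m ℕ.+ m)) * [ suc (m ℕ.+ m) ] q)) (ℕP.n≡⌈n+n/2⌉ m) ⟩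
    (1# - q) ^ suc ℕ.⌈ m ℕ.+ m /2⌉ * (∏brackets₁ (suc (m ℕ.+ m)) * [ suc (m ℕ.+ m) ] q) ∎
    where
    B = [ suc (m ℕ.+ m) ] ((sgn Sign.- ^ suc (suc (m ℕ.+ m))) * q)

  rhs₂den*rhs₁≈rhs₂num : ∀ ε k → rhs₂den ε (suc k) q * rhs₁ ε (suc k) q ≈ rhs₂num ε (suc k) q
  rhs₂den*rhs₁≈rhs₂num ε k = begin
    D * ((x * prodR (map twisted (upTo k))) * [ k ] x)
      ≈⟨ *-congˡ (*-congʳ (*-congˡ (prodR-upTo k twisted))) ⟩
    D * ((x * ∏brackets ε k) * [ k ] x)
      ≈⟨ solve 4 (λ d x p b → d :* ((x :* p) :* b) := x :* (d :* (p :* b))) refl D x (∏brackets ε k) ([ k ] x) ⟩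
    x * (D * (∏brackets ε k * [ k ] x))
      ≈⟨ *-congˡ (twisted≈untwisted ε k) ⟩
    x * (Z * (∏brackets₁ k * [ k ] q))
      ≈⟨ solve 4 (λ z x p b → x :* (z :* (p :* b)) := ((x :* z) :* p) :* b) refl Z x (∏brackets₁ k) ([ k ] q) ⟩
    ((x * Z) * ∏brackets₁ k) * [ k ] q
      ≈⟨ *-congʳ (*-congˡ (prodR-upTo k _)) ⟨
    rhs₂num ε (suc k) q ∎
    where
    x = (sgn ε ^ suc k) * q
    D = rhs₂den ε (suc k) q
    Z = (1# - q) ^ ℕ.⌈ suc k /2⌉
    twisted : ℕ → Carrier
    twisted i = [ 2 ℕ.* suc i ] ((sgn ε ^ suc i) * q)

proposition5p2 : ∀ {c ℓ : Level} (R : CommutativeRing c ℓ) (ε : Sign) (n : ℕ) → 2 ≤ n →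
    (q : CommutativeRing.Carrier R) →
    CommutativeRing._≈_ R (RingDefs.lhs R ε n q) (RingDefs.rhs₁ R ε n q)
    × CommutativeRing._≈_ R (CommutativeRing._*_ R (RingDefs.rhs₂den R ε n q) (RingDefs.rhs₁ R ε n q)) (RingDefs.rhs₂num R ε n q)
-- n ≥ 2 only serves to exclude n = 0.
proposition5p2 R ε (suc k) _ q =
  trans (lhs≈∑sumEndingIn k) (∑sumEndingIn≈rhs₁ k) , SecondForm.rhs₂den*rhs₁≈rhs₂num R q ε k
  where
  open CommutativeRing R using (trans)
  open LastLetterSums R ε q
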